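{- Let $n,p,q,r$ be positive integers with $q\ge r$. Then $$ \sum_{\ell=0}^n \ell^{p}H_{\ell}^{(q,r)}=\sum_{y=0}^{p+r} b(p,r,n,y)\, H_{n}^{(q-y)}, $$ where $$ b(p,r,n,0)=\sum_{j=0}^{r-1} \hat{a}(r,0,j)\, A(p+j,n), $$ for $1\le y\le r-1$, $$ b(p,r,n,y)=\sum_{j=0}^{r-1-y} \hat{a}(r,y,j)\, A(p+j,n)-\sum_{\substack{m+t=y\\ 0 \le m\le r-1\\ 1 \le t \le p+r-m}} \ \sum_{j=\max\{0,t-p-1\}}^{r-1-m} \hat{a}(r,m,j)\, H(p+j,t), $$ and for $r\le y\le p+r$, $$ b(p,r,n,y)=-\sum_{\substack{m+t=y\\ 0 \le m\le r-1\\ 1 \le t \le p+r-m}} \ \sum_{j=\max\{0,t-p-1\}}^{r-1-m} \hat{a}(r,m,j)\, H(p+j,t). $$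
   Context: For every integer $m$ (possibly zero or negative) and $n\ge 0$, $H_n^{(m)}=\sum_{j=1}^n j^{ -m}$ (so $H_0^{(m)}=0$). Generalized hyperharmonic numbers: $H_n^{(q,1)}=H_n^{(q)}$ and $H_n^{(q,r)}=\sum_{j=1}^n H_j^{(q,r-1)}$ for $r\ge 2$, $n\ge 0$. $S(k,i)$ are Stirling numbers of the second kind ($x^k=\sum_i S(k,i)x(x-1)\cdots(x-i+1)$) and $s(k,i)$ are (signed) Stirling numbers of the first kind ($x(x-1)\cdots(x-k+1)=\sum_i s(k,i)x^i$), with $S(0,0)=s(0,0)=1$. Define $A(k,n)=\sum_{i=0}^{k} S(k,i)\, i!\binom{n+1}{i+1}$ and $H(k,t)=\sum_{i=t-1}^{k}\frac{1}{i+1}S(k,i)\,s(i+1,t)$. Bernoulli numbers $B_m^{+}$ are defined by $\frac{x}{1-e^{ -x}}=\sum_{m\ge0}B_m^{+}\frac{x^m}{m!}$. The numbers $\hat a(r,m,j)$, for $r\ge1$, $0\le m\le r-1$, $0\le j\le r-1-m$, are defined recursively by $\hat a(1,0,0)=1$ and, for $r\ge1$: $\hat{a}(r+1,r,0)=-\sum_{m=0}^{r-1} \hat{a}(r,m,r-m-1)\frac{1}{r-m}$; $\hat{a}(r+1,m,\ell)=\sum_{j=\ell-1}^{r-1-m} \frac{\hat{a}(r,m,j)}{j+1} \binom{j+1}{j-\ell+1}B_{j-\ell+1}^{+}$ for $0\le m\le r-1$, $1\le \ell\le r-m$; $\hat{a}(r+1,m,0)=-\sum_{y=0}^{m} \sum_{j=\max\{0,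 m-y-1\}}^{r-1-y}\hat{a}(r,y,j)D(r,m,j,y)$ for $0\le m\le r-1$, where $D(r,m,j,y)=\sum_{\ell=\max\{0, m-y-1\}}^{j} \frac{1}{j+1} \binom{j+1}{j-\ell}B_{j-\ell}^{+}\binom{\ell+1}{m-y}(-1)^{1+\ell-m+y}$. -}

module Defs where

open import Data.Nat as ℕ using (ℕ; zero; suc; _∸_; _≤?_; _!)
open import Data.Nat.Combinatorics using (_C_)
open import Data.Integer as ℤ using (ℤ; +_; -[1+_])
open import Data.Rational using (ℚ; _/_; _+_; _*_; -_; _-_; 0ℚ; 1ℚ)
open import Data.Bool using (Bool; true; false; if_then_else_)
open import Relation.Nullary.Decidable using (⌊_⌋)

ℕ→ℚ : ℕ → ℚ
ℕ→ℚ k = + k / 1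

ℤ→ℚ : ℤ → ℚ
ℤ→ℚ z = z / 1

inv1+ : ℕ → ℚ
inv1+ k = + 1 / suc k

qpow : ℚ → ℕ → ℚ
qpow x zero    = 1ℚ
qpow x (suc k) = x * qpow x k

sgn : ℕ → ℚ
sgn zero    = 1ℚ
sgn (suc k) = - sgn k

-- Σ_{i=a}^{b} f i   (empty, i.e. 0, when b < a)
sumFrom : ℕ → ℕ → (ℕ → ℚ) → ℚ
sumFrom a zero    f = 0ℚ
sumFrom a (suc k) f = f a + sumFrom (suc a) k f

Σ[_to_] : ℕ → ℕ → (ℕ → ℚ) → ℚ
Σ[ a to b ] f = sumFrom a (suc b ∸ a) f

_≤ᵇ_ : ℕ → ℕ → Bool
m ≤ᵇ n = ⌊ m ≤? n ⌋

_≡ᵇ_ : ℕ → ℕ → Bool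
m ≡ᵇ n = ⌊ m ℕ.≟ n ⌋

max : ℕ → ℕ → ℕ
max = ℕ._⊔_

-- j^{-m} for j ≥ 1 and integer m (value at j = 0 is irrelevant, set 0)
negPow : ℕ → ℤ → ℚ
negPow zero    m        = 0ℚ
negPow (suc j) (+ k)    = qpow (inv1+ j) k
negPow (suc j) -[1+ k ] = qpow (ℕ→ℚ (suc j)) (suc k)

harm : ℤ → ℕ → ℚ
harm m n = Σ[ 1 to n ] (λ j → negPow j m)

-- generalized hyperharmonic numbers H_n^{(q,r)}, r ≥ 1 (r = 0 unused, set 0)
hyper : ℤ → ℕ → ℕ → ℚ
hyper q zero          n = 0ℚ
hyper q (suc zero)    n = harm q n
hyper q (suc (suc r)) n = Σ[ 1 to n ] (λ j → hyper q (suc r) j)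

-- Stirling numbers of the second kind S(k,i) (standard recurrence,
-- equivalent to x^k = Σ_i S(k,i) x(x-1)...(x-i+1))
S₂ : ℕ → ℕ → ℤ
S₂ zero    zero    = + 1
S₂ zero    (suc i) = + 0
S₂ (suc k) zero    = + 0
S₂ (suc k) (suc i) = (+ suc i) ℤ.* S₂ k (suc i) ℤ.+ S₂ k i

-- signed Stirling numbers of the first kind s(k,i)
-- (x(x-1)...(x-k+1) = Σ_i s(k,i) x^i)
s₁ : ℕ → ℕ → ℤ
s₁ zero    zero    = + 1
s₁ zero    (suc i) = + 0
s₁ (suc k) zero    = ℤ.- ((+ k) ℤ.* s₁ k zero)
s₁ (suc k) (suc i) = s₁ k i ℤ.- ((+ k) ℤ.* s₁ k (suc i))

A : ℕ → ℕ → ℚ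
A k n = Σ[ 0 to k ] (λ i → ℤ→ℚ (S₂ k i) * ℕ→ℚ ((i !) ℕ.* (suc n C suc i)))

Hs : ℕ → ℕ → ℚ
Hs k t = Σ[ t ∸ 1 to k ] (λ i → inv1+ i * ℤ→ℚ (S₂ k i) * ℤ→ℚ (s₁ (suc i) t))

-- Bernoulli numbers B⁺_m, x/(1-e^{-x}) = Σ B⁺_m x^m/m!.
-- Comparing coefficients of x^m in (x/(1-e^{-x})) * ((1-e^{-x})/x) = 1,
-- where (1-e^{-x})/x = Σ_k (-1)^k x^k/(k+1)!, gives B⁺_0 = 1 and
-- B⁺_m = - Σ_{k=1}^m (-1)^k C(m,k)/(k+1) B⁺_{m-k}  for m ≥ 1.
-- bernTable m i = B⁺_i for all i ≤ m.
bernTable : ℕ → ℕ → ℚ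
bernTable zero    i = 1ℚ
bernTable (suc m) i =
  if i ≤ᵇ m then bernTable m i
  else - (Σ[ 1 to suc m ] (λ k → sgn k * ℕ→ℚ (suc m C k) * inv1+ k * bernTable m (suc m ∸ k)))

B⁺ : ℕ → ℚ
B⁺ m = bernTable m m

D : ℕ → ℕ → ℕ → ℕ → ℚ
D r m j y = Σ[ max 0 (m ∸ y ∸ 1) to j ] (λ ℓ →
  inv1+ j * ℕ→ℚ (suc j C (j ∸ ℓ)) * B⁺ (j ∸ ℓ) * ℕ→ℚ (suc ℓ C (m ∸ y))
    * ℤ→ℚ ((ℤ.-1ℤ) ℤ.^ ℤ.∣ (+ 1) ℤ.+ (+ ℓ) ℤ.- (+ m) ℤ.+ (+ y) ∣ ))

-- â(r,m,j); defined for r ≥ 1, 0 ≤ m ≤ r-1, 0 ≤ j ≤ r-1-m; 0 elsewhere.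
-- (-1)^e for integer e equals (-1)^|e|.
âstep : ℕ → (ℕ → ℕ → ℚ) → ℕ → ℕ → ℚ
-- âstep r a m ℓ = â(r+1,m,ℓ) given a = â(r,·,·), r ≥ 1
âstep r a m zero =
  if m ≡ᵇ r then - (Σ[ 0 to r ∸ 1 ] (λ m' → a m' (r ∸ m' ∸ 1) * inv1+ (r ∸ m' ∸ 1)))
  else if suc m ≤ᵇ r then
    - (Σ[ 0 to m ] (λ y → Σ[ max 0 (m ∸ y ∸ 1) to r ∸ 1 ∸ y ] (λ j → a y j * D r m j y)))
  else 0ℚ
âstep r a m (suc ℓ') =
  if (suc m ≤ᵇ r) Data.Bool.∧ (suc ℓ' ≤ᵇ (r ∸ m)) then
    Σ[ ℓ' to r ∸ 1 ∸ m ] (λ j → a m j * inv1+ j * ℕ→ℚ (suc j C (j ∸ ℓ')) * B⁺ (j ∸ ℓ'))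
  else 0ℚ

â : ℕ → ℕ → ℕ → ℚ
â zero          m j = 0ℚ
â (suc zero)    m j = if (m ≡ᵇ 0) Data.Bool.∧ (j ≡ᵇ 0) then 1ℚ else 0ℚ
â (suc (suc r)) m j = âstep (suc r) (â (suc r)) m j

corr : ℕ → ℕ → ℕ → ℚ
corr p r y = Σ[ 0 to r ∸ 1 ] (λ m → Σ[ 1 to p ℕ.+ r ∸ m ] (λ t →
  if (m ℕ.+ t) ≡ᵇ y
  then Σ[ max 0 (t ∸ p ∸ 1) to r ∸ 1 ∸ m ] (λ j → â r m j * Hs (p ℕ.+ j) t)
  else 0ℚ))

b : ℕ → ℕ → ℕ → ℕ → ℚ
b p r n zero = Σ[ 0 to r ∸ 1 ] (λ j → â r 0 j * A (p ℕ.+ j) n)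
b p r n (suc y') =
  if suc y' ≤ᵇ (r ∸ 1)
  then Σ[ 0 to r ∸ 1 ∸ suc y' ] (λ j → â r (suc y') j * A (p ℕ.+ j) n) - corr p r (suc y')
  else - corr p r (suc y')

-- Write Φ_j(n) = Σ_{i ≤ n} i^j = Σ_ℓ B⁺_{j-ℓ} C(j+1, j-ℓ) n^{ℓ+1} / (j+1)
-- (Faulhaber) and expand it in powers of n + 1 as Σ_u ψ_j(u) (n+1)^u.  Abel summation gives
--   Σ_{ℓ ≤ n} ℓ^j H_ℓ^{(z)} = Φ_j(n) H_n^{(z)} - Σ_u ψ_j(u) H_n^{(z-u)},
-- because (n+1)^u (n+1)^{-z} = (n+1)^{-(z-u)}.  Induction on r with this formula shows
--   H_n^{(z,r)} = Σ_{m,j} â(r,m,j) n^j H_n^{(z-m)}: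
-- the recursion defining â is exactly the re-collection of the coefficients of n^{ℓ+1}
-- (from Φ_j) and of H_n^{(z-m-u)} (from ψ_j, which is the paper's D).  Multiplying by ℓ^p
-- and summing once more by parts, now with A(k,n) = Σ_{i ≤ n} i^k = Σ_u H(k,u) (n+1)^u
-- (Stirling numbers), gives Σ_{m,j} â(r,m,j) (A(p+j,n) H_n^{(z-m)} - Σ_t H(p+j,t) H_n^{(z-m-t)}),
-- and grouping the terms by y = m + t yields the coefficients b(p,r,n,y).

module Submission where

open import Defs
open import Data.Nat as ℕ using (ℕ; zero; suc; _∸_; _≤_; _<_; z≤n; s≤s; _!)
open import Data.Nat.Combinatorics using (_C_; nCk+nC[k+1]≡[n+1]C[k+1]; k>n⇒nCk≡0; k![n∸k]!∣n!; nCn≡1; nC1≡n; nCk≡nC[n∸k])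
open import Data.Nat.Combinatorics.Specification using (nCk≡n!/k![n-k]!)
open import Data.Nat.DivMod using (m/n*n≡m)
import Data.Nat.Properties as NP
open import Data.Integer as ℤ using (ℤ; +_; -[1+_])
import Data.Integer.Properties as ZP
open import Data.Rational as Q using (ℚ; 0ℚ; 1ℚ; _+_; _*_; -_; _-_; mkℚ)
open import Data.Rational.Properties
open import Relation.Binary.PropositionalEquality
open import Data.Nat.Coprimality as Cop using (1-coprimeTo)
open import Data.Bool using (true; false; _∧_; if_then_else_)
open import Relation.Nullary using (yes; no; ¬_; Dec)
open import Relation.Nullary.Decidable using (⌊_⌋)
open import Data.Empty using (⊥-elim)
open import Relation.Binary using (Tri; tri<; tri≈; tri>)
open import Data.Rational.Solver
open +-*-Solver using (solve; _:=_; _:+_; _:*_; :-_; _:-_; con)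
import Data.Nat.Solver
module NS = Data.Nat.Solver.+-*-Solver
import Data.Integer.Solver
module ZS = Data.Integer.Solver.+-*-Solver

-- Finite sums

sumFrom-cong : ∀ a k (f g : ℕ → ℚ) → (∀ i → a ≤ i → i < a ℕ.+ k → f i ≡ g i) → sumFrom a k f ≡ sumFrom a k g
sumFrom-cong a zero f g h = refl
sumFrom-cong a (suc k) f g h = cong₂ _+_ (h a NP.≤-refl (NP.m<m+n a (s≤s z≤n)))
  (sumFrom-cong (suc a) k f g (λ i a<i i<  → h i (NP.<⇒≤ a<i) (subst (i <_) (sym (NP.+-suc a k)) i<)))

sumFrom-suc : ∀ a k (f : ℕ → ℚ) → sumFrom (suc a) k f ≡ sumFrom a k (λ i → f (suc i))
sumFrom-suc a zero f = refl
sumFrom-suc a (suc k) f = cong (λ w → f (suc a) + w) (sumFrom-suc (suc a) k f)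

sumFrom-offset : ∀ a k (f : ℕ → ℚ) → sumFrom a k f ≡ sumFrom 0 k (λ i → f (a ℕ.+ i))
sumFrom-offset zero k f = refl
sumFrom-offset (suc a) k f = trans (sumFrom-suc a k f) (sumFrom-offset a k (λ i → f (suc i)))

sumFrom-+ : ∀ a k (f g : ℕ → ℚ) → sumFrom a k (λ i → f i + g i) ≡ sumFrom a k f + sumFrom a k g
sumFrom-+ a zero f g = refl
sumFrom-+ a (suc k) f g = trans (cong (λ w → f a + g a + w) (sumFrom-+ (suc a) k f g))
  (solve 4 (λ x y z w → x :+ y :+ (z :+ w) := x :+ z :+ (y :+ w)) refl (f a) (g a) (sumFrom (suc a) k f) (sumFrom (suc a) k g))

*-distribˡ-sumFrom : ∀ a k c (f : ℕ → ℚ) → c * sumFrom a k f ≡ sumFrom a k (λ i → c * f i)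
*-distribˡ-sumFrom a zero c f = *-zeroʳ c
*-distribˡ-sumFrom a (suc k) c f = trans (*-distribˡ-+ c (f a) _) (cong (λ w → c * f a + w) (*-distribˡ-sumFrom (suc a) k c f))

*-distribʳ-sumFrom : ∀ a k c (f : ℕ → ℚ) → sumFrom a k f * c ≡ sumFrom a k (λ i → f i * c)
*-distribʳ-sumFrom a k c f = trans (*-comm _ c) (trans (*-distribˡ-sumFrom a k c f) (sumFrom-cong a k _ _ (λ i _ _ → *-comm c (f i))))

neg-distrib-sumFrom : ∀ a k (f : ℕ → ℚ) → - sumFrom a k f ≡ sumFrom a k (λ i → - f i)
neg-distrib-sumFrom a zero f = refl
neg-distrib-sumFrom a (suc k) f = trans (neg-distrib-+ (f a) _) (cong (λ w → - f a + w) (neg-distrib-sumFrom (suc a) k f))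

sumFrom-zero : ∀ a k (f : ℕ → ℚ) → (∀ i → a ≤ i → i < a ℕ.+ k → f i ≡ 0ℚ) → sumFrom a k f ≡ 0ℚ
sumFrom-zero a zero f h = refl
sumFrom-zero a (suc k) f h = trans (cong₂ _+_ (h a NP.≤-refl (NP.m<m+n a (s≤s z≤n)))
  (sumFrom-zero (suc a) k f (λ i a<i i<  → h i (NP.<⇒≤ a<i) (subst (i <_) (sym (NP.+-suc a k)) i<)))) (+-identityˡ 0ℚ)

sumFrom-split : ∀ a k l (f : ℕ → ℚ) → sumFrom a (k ℕ.+ l) f ≡ sumFrom a k f + sumFrom (a ℕ.+ k) l f
sumFrom-split a zero l f = sym (trans (+-identityˡ _) (cong (λ z → sumFrom z l f) (NP.+-identityʳ a)))
sumFrom-split a (suc k) l f = trans (cong (λ w → f a + w) (sumFrom-split (suc a) k l f))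
  (trans (sym (+-assoc (f a) _ _)) (cong (λ z → f a + sumFrom (suc a) k f + sumFrom z l f) (sym (NP.+-suc a k))))

sumFrom-snoc : ∀ a k (f : ℕ → ℚ) → sumFrom a (suc k) f ≡ sumFrom a k f + f (a ℕ.+ k)
sumFrom-snoc a k f = trans (cong (λ z → sumFrom a z f) (NP.+-comm 1 k))
  (trans (sumFrom-split a k 1 f) (cong (λ w → sumFrom a k f + w) (+-identityʳ _)))

sumFrom-swap : ∀ a k b l (f : ℕ → ℕ → ℚ) →
  sumFrom a k (λ i → sumFrom b l (λ j → f i j)) ≡ sumFrom b l (λ j → sumFrom a k (λ i → f i j))
sumFrom-swap a zero b l f = sym (sumFrom-zero b l _ (λ _ _ _ → refl))
sumFrom-swap a (suc k) b l f = trans (cong (λ w → sumFrom b l (λ j → f a j) + w) (sumFrom-swap (suc a) k b l f))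
  (sym (sumFrom-+ b l _ _))

sumFrom-swap₃ : ∀ a k b l c o (f : ℕ → ℕ → ℕ → ℚ) →
  sumFrom a k (λ i → sumFrom b l (λ j → sumFrom c o (f i j)))
    ≡ sumFrom b l (λ j → sumFrom c o (λ h → sumFrom a k (λ i → f i j h)))
sumFrom-swap₃ a k b l c o f = trans (sumFrom-swap a k b l (λ i j → sumFrom c o (f i j)))
  (sumFrom-cong b l _ _ (λ j _ _ → sumFrom-swap a k c o (λ i h → f i j h)))

sumFrom²-minus : ∀ a k b l (f g : ℕ → ℕ → ℚ) →
  sumFrom a k (λ i → sumFrom b l (λ j → f i j + - g i j))
    ≡ sumFrom a k (λ i → sumFrom b l (f i)) + - sumFrom a k (λ i → sumFrom b l (g i))
sumFrom²-minus a k b l f g = begin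
    sumFrom a k (λ i → sumFrom b l (λ j → f i j + - g i j))
  ≡⟨ sumFrom-cong a k _ _ (λ i _ _ → trans (sumFrom-+ b l (f i) (λ j → - g i j))
       (cong (λ w → sumFrom b l (f i) + w) (sym (neg-distrib-sumFrom b l (g i))))) ⟩
    sumFrom a k (λ i → sumFrom b l (f i) + - sumFrom b l (g i))
  ≡⟨ sumFrom-+ a k _ _ ⟩
    sumFrom a k (λ i → sumFrom b l (f i)) + sumFrom a k (λ i → - sumFrom b l (g i))
  ≡⟨ cong (λ w → sumFrom a k (λ i → sumFrom b l (f i)) + w) (sym (neg-distrib-sumFrom a k _)) ⟩
    sumFrom a k (λ i → sumFrom b l (f i)) + - sumFrom a k (λ i → sumFrom b l (g i)) ∎
  where open ≡-Reasoning

sumFrom-padZeros : ∀ a k l (f : ℕ → ℚ) → (∀ i → a ℕ.+ k ≤ i → i < a ℕ.+ k ℕ.+ l → f i ≡ 0ℚ) →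
  sumFrom a (k ℕ.+ l) f ≡ sumFrom a k f
sumFrom-padZeros a k l f h = trans (sumFrom-split a k l f) (trans (cong (λ w → sumFrom a k f + w) (sumFrom-zero _ l f h)) (+-identityʳ _))

sumFrom-single : ∀ a k (f : ℕ → ℚ) c → a ≤ c → c < a ℕ.+ k → (∀ i → a ≤ i → i < a ℕ.+ k → i ≢ c → f i ≡ 0ℚ) →
  sumFrom a k f ≡ f c
sumFrom-single a zero f c a≤c c< h = ⊥-elim (NP.<-irrefl refl (NP.≤-trans c< (subst (_≤ c) (sym (NP.+-identityʳ a)) a≤c)))
sumFrom-single a (suc k) f c a≤c c< h with a ℕ.≟ c
... | yes refl = trans (cong (λ w → f a + w) (sumFrom-zero (suc a) k f (λ i a<i i< → h i (NP.<⇒≤ a<i) (subst (i <_) (sym (NP.+-suc a k)) i<) (λ e → NP.<-irrefl (sym e) a<i)))) (+-identityʳ _)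
... | no a≢c = trans (cong (_+ sumFrom (suc a) k f) (h a NP.≤-refl (NP.m<m+n a (s≤s z≤n)) a≢c))
  (trans (+-identityˡ _) (sumFrom-single (suc a) k f c (NP.≤∧≢⇒< a≤c a≢c) (subst (c <_) (NP.+-suc a k) c<)
    (λ i a<i i< i≢c → h i (NP.<⇒≤ a<i) (subst (i <_) (sym (NP.+-suc a k)) i<) i≢c)))

sumFrom-extend : ∀ a k K (f : ℕ → ℚ) → k ≤ K → (∀ i → a ℕ.+ k ≤ i → i < a ℕ.+ K → f i ≡ 0ℚ) →
  sumFrom a K f ≡ sumFrom a k f
sumFrom-extend a k K f k≤K h = trans (cong (λ z → sumFrom a z f) (sym (NP.m+[n∸m]≡n k≤K)))
  (sumFrom-padZeros a k (K ∸ k) f (λ i p q → h i p (subst (λ z → i < a ℕ.+ z) (NP.m+[n∸m]≡n k≤K) (subst (i <_) (NP.+-assoc a k (K ∸ k)) q))))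

sumFrom-dropZeros : ∀ a b (f : ℕ → ℚ) → a ≤ b → (∀ i → i < a → f i ≡ 0ℚ) → sumFrom a (b ∸ a) f ≡ sumFrom 0 b f
sumFrom-dropZeros a b f a≤b h = sym (trans (cong (λ z → sumFrom 0 z f) (sym (NP.m+[n∸m]≡n a≤b)))
  (trans (sumFrom-split 0 a (b ∸ a) f) (trans (cong (_+ sumFrom a (b ∸ a) f) (sumFrom-zero 0 a f (λ i _ i< → h i i<))) (+-identityˡ _))))

sumFrom-head : ∀ N (f : ℕ → ℚ) → sumFrom 0 (suc N) f ≡ f 0 + sumFrom 0 N (λ t → f (suc t))
sumFrom-head N f = cong (λ w → f 0 + w) (sumFrom-suc 0 N f)

sumFrom-suc-dropHead : ∀ N (h : ℕ → ℚ) → h N ≡ 0ℚ → sumFrom 0 N (λ u → h (suc u)) ≡ sumFrom 0 N h - h 0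
sumFrom-suc-dropHead N h hN = begin
    Y
  ≡⟨ solve 2 (λ Y a → Y := a :+ Y :- a) refl Y (h 0) ⟩
    h 0 + Y - h 0
  ≡⟨ cong (_- h 0) (sym (sumFrom-head N h)) ⟩
    sumFrom 0 (suc N) h - h 0
  ≡⟨ cong (_- h 0) (trans (sumFrom-snoc 0 N h) (trans (cong (λ w → sumFrom 0 N h + w) hN) (+-identityʳ (sumFrom 0 N h)))) ⟩
    sumFrom 0 N h - h 0 ∎
  where
  open ≡-Reasoning
  Y = sumFrom 0 N (λ u → h (suc u))

sumFrom-window : ∀ a b N (f : ℕ → ℚ) → suc b ≤ N → (∀ j → j < a → f j ≡ 0ℚ) → (∀ j → b < j → j < N → f j ≡ 0ℚ) →
  sumFrom a (suc b ∸ a) f ≡ sumFrom 0 N f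
sumFrom-window a b N f sb≤N lo hi with a ℕ.≤? suc b
... | yes a≤ = trans (sumFrom-dropZeros a (suc b) f a≤ lo) (sym (sumFrom-extend 0 (suc b) N f sb≤N (λ j p q → hi j p q)))
... | no a> = trans (cong (λ w → sumFrom a w f) (NP.m≤n⇒m∸n≡0 (NP.<⇒≤ (NP.≰⇒> a>))))
   (sym (sumFrom-zero 0 N f (λ j _ j< → aux j j<)))
  where
  aux : ∀ j → j < N → f j ≡ 0ℚ
  aux j j< with j ℕ.<? a
  ... | yes p = lo j p
  ... | no p = hi j (NP.<-≤-trans (NP.n<1+n b) (NP.≤-trans (NP.<⇒≤ (NP.≰⇒> a>)) (NP.≮⇒≥ p))) j<

sumFrom-triangle : ∀ R (f : ℕ → ℕ → ℚ) → sumFrom 0 R (λ j → sumFrom 0 (suc j) (f j))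
         ≡ sumFrom 0 R (λ ℓ → sumFrom ℓ (R ∸ ℓ) (λ j → f j ℓ))
sumFrom-triangle zero f = refl
sumFrom-triangle (suc R) f = begin
    sumFrom 0 (suc R) (λ j → sumFrom 0 (suc j) (f j))
  ≡⟨ sumFrom-snoc 0 R (λ j → sumFrom 0 (suc j) (f j)) ⟩
    sumFrom 0 R (λ j → sumFrom 0 (suc j) (f j)) + sumFrom 0 (suc R) (f R)
  ≡⟨ cong (_+ sumFrom 0 (suc R) (f R)) (sumFrom-triangle R f) ⟩
    sumFrom 0 R (λ ℓ → sumFrom ℓ (R ∸ ℓ) (λ j → f j ℓ)) + sumFrom 0 (suc R) (f R)
  ≡⟨ cong (_+ sumFrom 0 (suc R) (f R)) (sym (trans (cong (λ w → X + sumFrom R w (λ j → f j R)) (NP.n∸n≡0 R)) (+-identityʳ X))) ⟩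
    sumFrom 0 R (λ ℓ → sumFrom ℓ (R ∸ ℓ) (λ j → f j ℓ)) + sumFrom R (R ∸ R) (λ j → f j R) + sumFrom 0 (suc R) (f R)
  ≡⟨ cong (_+ sumFrom 0 (suc R) (f R)) (sym (sumFrom-snoc 0 R (λ ℓ → sumFrom ℓ (R ∸ ℓ) (λ j → f j ℓ)))) ⟩
    sumFrom 0 (suc R) (λ ℓ → sumFrom ℓ (R ∸ ℓ) (λ j → f j ℓ)) + sumFrom 0 (suc R) (f R)
  ≡⟨ sym (sumFrom-+ 0 (suc R) (λ ℓ → sumFrom ℓ (R ∸ ℓ) (λ j → f j ℓ)) (f R)) ⟩
    sumFrom 0 (suc R) (λ ℓ → sumFrom ℓ (R ∸ ℓ) (λ j → f j ℓ) + f R ℓ)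
  ≡⟨ sumFrom-cong 0 (suc R) _ _ (λ ℓ _ ℓ< → step ℓ (NP.≤-pred ℓ<)) ⟩
    sumFrom 0 (suc R) (λ ℓ → sumFrom ℓ (suc R ∸ ℓ) (λ j → f j ℓ)) ∎
  where
  open ≡-Reasoning
  X = sumFrom 0 R (λ ℓ → sumFrom ℓ (R ∸ ℓ) (λ j → f j ℓ))
  step : ∀ ℓ → ℓ ≤ R → sumFrom ℓ (R ∸ ℓ) (λ j → f j ℓ) + f R ℓ ≡ sumFrom ℓ (suc R ∸ ℓ) (λ j → f j ℓ)
  step ℓ ℓ≤R = sym (trans (cong (λ w → sumFrom ℓ w (λ j → f j ℓ)) (NP.+-∸-assoc 1 ℓ≤R))
    (trans (sumFrom-snoc ℓ (R ∸ ℓ) (λ j → f j ℓ)) (cong (λ w → sumFrom ℓ (R ∸ ℓ) (λ j → f j ℓ) + f w ℓ) (NP.m+[n∸m]≡n ℓ≤R))))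

shiftArg : ℕ → (ℕ → ℚ) → ℕ → ℚ
shiftArg zero g M = g M
shiftArg (suc m) g zero = 0ℚ
shiftArg (suc m) g (suc M) = shiftArg m g M

shiftArg-val : ∀ m g M → m ≤ M → shiftArg m g M ≡ g (M ∸ m)
shiftArg-val zero g M _ = refl
shiftArg-val (suc m) g (suc M) (s≤s p) = shiftArg-val m g M p

shiftArg-vanish : ∀ m g M → M < m → shiftArg m g M ≡ 0ℚ
shiftArg-vanish (suc m) g zero _ = refl
shiftArg-vanish (suc m) g (suc M) (s≤s p) = shiftArg-vanish m g M p

shiftArg-sum : ∀ m g (h : ℕ → ℚ) K → sumFrom 0 K (λ M → shiftArg m g M * h M) ≡ sumFrom 0 (K ∸ m) (λ u → g u * h (m ℕ.+ u))
shiftArg-sum zero g h K = refl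
shiftArg-sum (suc m) g h zero = refl
shiftArg-sum (suc m) g h (suc K) = trans (sumFrom-head K (λ M → shiftArg (suc m) g M * h M))
  (trans (cong (_+ sumFrom 0 K (λ M → shiftArg m g M * h (suc M))) (*-zeroˡ (h 0)))
   (trans (+-identityˡ _) (shiftArg-sum m g (λ M → h (suc M)) K)))

ℤ→ℚ-mkℚ : ∀ z → ℤ→ℚ z ≡ mkℚ z 0 (Cop.sym (1-coprimeTo ℤ.∣ z ∣))
ℤ→ℚ-mkℚ z = ↥p/↧p≡p (mkℚ z 0 (Cop.sym (1-coprimeTo ℤ.∣ z ∣)))

ℤ→ℚ-+ : ∀ a b → ℤ→ℚ (a ℤ.+ b) ≡ ℤ→ℚ a + ℤ→ℚ b
ℤ→ℚ-+ a b = trans (cong (λ z → z Q./ 1) (cong₂ ℤ._+_ (sym (ZP.*-identityʳ a)) (sym (ZP.*-identityʳ b))))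
  (sym (cong₂ _+_ (ℤ→ℚ-mkℚ a) (ℤ→ℚ-mkℚ b)))

ℤ→ℚ-* : ∀ a b → ℤ→ℚ (a ℤ.* b) ≡ ℤ→ℚ a * ℤ→ℚ b
ℤ→ℚ-* a b = sym (cong₂ _*_ (ℤ→ℚ-mkℚ a) (ℤ→ℚ-mkℚ b))

ℤ→ℚ-neg : ∀ a → ℤ→ℚ (ℤ.- a) ≡ - ℤ→ℚ a
ℤ→ℚ-neg a = trans (ℤ→ℚ-mkℚ (ℤ.- a)) (trans (negate-mkℚ a) (cong -_ (sym (ℤ→ℚ-mkℚ a))))
  where
  negate-mkℚ : ∀ a → mkℚ (ℤ.- a) 0 (Cop.sym (1-coprimeTo ℤ.∣ ℤ.- a ∣)) ≡ - mkℚ a 0 (Cop.sym (1-coprimeTo ℤ.∣ a ∣))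
  negate-mkℚ (+ zero) = refl
  negate-mkℚ (+ suc n) = refl
  negate-mkℚ -[1+ n ] = refl

ℤ→ℚ-minus : ∀ a b → ℤ→ℚ (a ℤ.- b) ≡ ℤ→ℚ a - ℤ→ℚ b
ℤ→ℚ-minus a b = trans (ℤ→ℚ-+ a (ℤ.- b)) (cong (λ w → ℤ→ℚ a + w) (ℤ→ℚ-neg b))

ℕ→ℚ-+ : ∀ a b → ℕ→ℚ (a ℕ.+ b) ≡ ℕ→ℚ a + ℕ→ℚ b
ℕ→ℚ-+ a b = trans (cong ℤ→ℚ (ZP.pos-+ a b)) (ℤ→ℚ-+ (+ a) (+ b))

ℕ→ℚ-* : ∀ a b → ℕ→ℚ (a ℕ.* b) ≡ ℕ→ℚ a * ℕ→ℚ b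
ℕ→ℚ-* a b = trans (cong ℤ→ℚ (ZP.pos-* a b)) (ℤ→ℚ-* (+ a) (+ b))

ℕ→ℚ-suc : ∀ a → ℕ→ℚ (suc a) ≡ 1ℚ + ℕ→ℚ a
ℕ→ℚ-suc a = ℕ→ℚ-+ 1 a

inv1+-inverse : ∀ k → inv1+ k * ℕ→ℚ (suc k) ≡ 1ℚ
inv1+-inverse k = toℚᵘ-injective (UP.≃-trans (toℚᵘ-homo-* (inv1+ k) (ℕ→ℚ (suc k)))
  (UP.≃-trans (UP.*-cong (toℚᵘ-fromℚᵘ (U.mkℚᵘ (+ 1) k)) (toℚᵘ-fromℚᵘ (U.mkℚᵘ (+ suc k) 0)))
     (U.*≡* (cross-product k))))
  where
  import Data.Rational.Unnormalised as U
  import Data.Rational.Unnormalised.Properties as UP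
  cross-product : ∀ k → (+ 1 ℤ.* + suc k) ℤ.* + 1 ≡ + 1 ℤ.* + (suc k ℕ.* 1)
  cross-product k = trans (ZP.*-identityʳ _) (trans (ZP.*-identityˡ _) (sym (trans (ZP.*-identityˡ _) (cong +_ (NP.*-identityʳ (suc k))))))

qpow-+ : ∀ x a b → qpow x (a ℕ.+ b) ≡ qpow x a * qpow x b
qpow-+ x zero b = sym (*-identityˡ _)
qpow-+ x (suc a) b = trans (cong (x *_) (qpow-+ x a b)) (sym (*-assoc x _ _))

pow : ℕ → ℕ → ℚ
pow x k = qpow (ℕ→ℚ x) k

ℤ→ℚ-[-1]^ : ∀ w → ℤ→ℚ ((ℤ.-1ℤ) ℤ.^ w) ≡ sgn w
ℤ→ℚ-[-1]^ zero = refl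
ℤ→ℚ-[-1]^ (suc w) = trans (cong ℤ→ℚ (ZP.-1*i≡-i ((ℤ.-1ℤ) ℤ.^ w))) (trans (ℤ→ℚ-neg ((ℤ.-1ℤ) ℤ.^ w)) (cong -_ (ℤ→ℚ-[-1]^ w)))

if-true : ∀ {b} {x y : ℚ} → b ≡ true → (if b then x else y) ≡ x
if-true refl = refl

if-false : ∀ {b} {x y : ℚ} → b ≡ false → (if b then x else y) ≡ y
if-false refl = refl

⌊⌋-true : ∀ {A : Set} (d : Dec A) → A → ⌊ d ⌋ ≡ true
⌊⌋-true (yes _) _ = refl
⌊⌋-true (no ¬a) a = ⊥-elim (¬a a)

⌊⌋-false : ∀ {A : Set} (d : Dec A) → ¬ A → ⌊ d ⌋ ≡ false
⌊⌋-false (yes a) ¬a = ⊥-elim (¬a a)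
⌊⌋-false (no _) _ = refl

≤ᵇ-true : ∀ {m n} → m ≤ n → (m ≤ᵇ n) ≡ true
≤ᵇ-true {m} {n} p = ⌊⌋-true (m ℕ.≤? n) p

≤ᵇ-false : ∀ {m n} → ¬ (m ≤ n) → (m ≤ᵇ n) ≡ false
≤ᵇ-false {m} {n} p = ⌊⌋-false (m ℕ.≤? n) p

≡ᵇ-true : ∀ {m n} → m ≡ n → (m ≡ᵇ n) ≡ true
≡ᵇ-true {m} {n} p = ⌊⌋-true (m ℕ.≟ n) p

≡ᵇ-false : ∀ {m n} → m ≢ n → (m ≡ᵇ n) ≡ false
≡ᵇ-false {m} {n} p = ⌊⌋-false (m ℕ.≟ n) p

∧-falseˡ : ∀ {a b} → a ≡ false → (a ∧ b) ≡ false
∧-falseˡ refl = refl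

∧-falseʳ : ∀ {a b} → a ≡ true → b ≡ false → (a ∧ b) ≡ false
∧-falseʳ refl refl = refl

∧-true : ∀ {a b} → a ≡ true → b ≡ true → (a ∧ b) ≡ true
∧-true refl refl = refl

-- Binomial coefficients

binomial-factorials : ∀ r s → ((r ℕ.+ s) C r) ℕ.* (r ! ℕ.* s !) ≡ (r ℕ.+ s) !
binomial-factorials r s = trans (cong (λ w → ((r ℕ.+ s) C r) ℕ.* (r ! ℕ.* w !)) (sym (NP.m+n∸m≡n r s)))
  (trans (cong (ℕ._* (r ! ℕ.* ((r ℕ.+ s) ∸ r) !)) (nCk≡n!/k![n-k]! (NP.m≤m+n r s)))
     (m/n*n≡m (k![n∸k]!∣n! (NP.m≤m+n r s))))
  where instance _ = (r NP.!* ((r ℕ.+ s) ∸ r) !≢0)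

binomial-product : ∀ u k a → suc k ℕ.* (((a ℕ.+ (u ℕ.+ suc k)) C a) ℕ.* ((u ℕ.+ suc k) C u))
             ≡ suc (k ℕ.+ a) ℕ.* (((u ℕ.+ suc (k ℕ.+ a)) C u) ℕ.* ((k ℕ.+ a) C k))
binomial-product u k a = NP.*-cancelʳ-≡ _ _ (a ! ℕ.* (u ! ℕ.* k !)) {{NP.m*n≢0 (a !) (u ! ℕ.* k !) {{NP._!≢0 a}} {{NP._!*_!≢0 u k}}}} (trans L (sym R))
  where
  C1 = (a ℕ.+ (u ℕ.+ suc k)) C a
  C2 = (u ℕ.+ suc k) C u
  C3 = (u ℕ.+ suc (k ℕ.+ a)) C u
  C4 = (k ℕ.+ a) C k
  L : suc k ℕ.* (C1 ℕ.* C2) ℕ.* (a ! ℕ.* (u ! ℕ.* k !)) ≡ (u ℕ.+ suc (k ℕ.+ a)) !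
  L = trans (NS.solve 6 (λ k C1 C2 A U K → (NS.con 1 NS.:+ k) NS.:* (C1 NS.:* C2) NS.:* (A NS.:* (U NS.:* K)) NS.:= C1 NS.:* (A NS.:* (C2 NS.:* (U NS.:* ((NS.con 1 NS.:+ k) NS.:* K))))) refl k C1 C2 (a !) (u !) (k !))
       (trans (cong (λ w → C1 ℕ.* (a ! ℕ.* w)) (binomial-factorials u (suc k)))
       (trans (binomial-factorials a (u ℕ.+ suc k)) (cong _! (eq u k a))))
    where
    eq : ∀ u k a → a ℕ.+ (u ℕ.+ suc k) ≡ u ℕ.+ suc (k ℕ.+ a)
    eq u k a = NS.solve 3 (λ u k a → a NS.:+ (u NS.:+ (NS.con 1 NS.:+ k)) NS.:= u NS.:+ (NS.con 1 NS.:+ (k NS.:+ a))) refl u k a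
  R : suc (k ℕ.+ a) ℕ.* (C3 ℕ.* C4) ℕ.* (a ! ℕ.* (u ! ℕ.* k !)) ≡ (u ℕ.+ suc (k ℕ.+ a)) !
  R = trans (NS.solve 7 (λ k a C3 C4 A U K → (NS.con 1 NS.:+ (k NS.:+ a)) NS.:* (C3 NS.:* C4) NS.:* (A NS.:* (U NS.:* K)) NS.:= C3 NS.:* (U NS.:* ((NS.con 1 NS.:+ (k NS.:+ a)) NS.:* (C4 NS.:* (K NS.:* A))))) refl k a C3 C4 (a !) (u !) (k !))
       (trans (cong (λ w → C3 ℕ.* (u ! ℕ.* (suc (k ℕ.+ a) ℕ.* w))) (binomial-factorials k a))
        (binomial-factorials u (suc (k ℕ.+ a))))

qpow-pred-binomial : ∀ x e → qpow (x - 1ℚ) e ≡ sumFrom 0 (suc e) (λ u → ℕ→ℚ (e C u) * qpow x u * sgn (e ∸ u))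
qpow-pred-binomial x zero = solve 0 (con 1ℚ := con 1ℚ :* con 1ℚ :* con 1ℚ :+ con 0ℚ) refl
qpow-pred-binomial x (suc e) = sym (begin
    sumFrom 0 (suc (suc e)) (λ u → ℕ→ℚ (suc e C u) * qpow x u * sgn (suc e ∸ u))
  ≡⟨ sumFrom-head (suc e) (λ u → ℕ→ℚ (suc e C u) * qpow x u * sgn (suc e ∸ u)) ⟩
    H + sumFrom 0 (suc e) (λ u → ℕ→ℚ (suc e C suc u) * qpow x (suc u) * sgn (e ∸ u))
  ≡⟨ cong (λ w → H + w) (sumFrom-cong 0 (suc e) _ _ (λ u _ _ → termeq u)) ⟩
    H + sumFrom 0 (suc e) (λ u → x * t u + h (suc u))
  ≡⟨ cong (λ w → H + w) (sumFrom-+ 0 (suc e) (λ u → x * t u) (λ u → h (suc u))) ⟩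
    H + (sumFrom 0 (suc e) (λ u → x * t u) + sumFrom 0 (suc e) (λ u → h (suc u)))
  ≡⟨ cong₂ (λ a b → H + (a + b)) (sym (*-distribˡ-sumFrom 0 (suc e) x t))
       (sumFrom-suc-dropHead (suc e) h (trans (cong (λ w → ℕ→ℚ w * qpow x (suc e) * sgn (suc e ∸ suc e)) (k>n⇒nCk≡0 (NP.n<1+n e)))
           (trans (cong (_* sgn (suc e ∸ suc e)) (*-zeroˡ (qpow x (suc e)))) (*-zeroˡ (sgn (e ∸ e)))))) ⟩
    H + (x * Q + (sumFrom 0 (suc e) h - H))
  ≡⟨ cong (λ w → H + (x * Q + (w - H))) hsum ⟩
    H + (x * Q + (- Q - H))
  ≡⟨ solve 3 (λ H x Q → H :+ (x :* Q :+ (:- Q :- H)) := (x :- con 1ℚ) :* Q) refl H x Q ⟩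
    (x - 1ℚ) * Q
  ≡⟨ cong ((x - 1ℚ) *_) (sym (qpow-pred-binomial x e)) ⟩
    (x - 1ℚ) * qpow (x - 1ℚ) e ∎)
  where
  open ≡-Reasoning
  t = λ u → ℕ→ℚ (e C u) * qpow x u * sgn (e ∸ u)
  h = λ u → ℕ→ℚ (e C u) * qpow x u * sgn (suc e ∸ u)
  Q = sumFrom 0 (suc e) t
  H = 1ℚ * 1ℚ * sgn (suc e)
  termeq : ∀ u → ℕ→ℚ (suc e C suc u) * qpow x (suc u) * sgn (e ∸ u) ≡ x * t u + h (suc u)
  termeq u = trans (cong (λ w → ℕ→ℚ w * qpow x (suc u) * sgn (e ∸ u)) (sym (nCk+nC[k+1]≡[n+1]C[k+1] e u)))
    (trans (cong (λ w → w * qpow x (suc u) * sgn (e ∸ u)) (ℕ→ℚ-+ (e C u) (e C suc u)))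
     (solve 5 (λ a b x q s → (a :+ b) :* (x :* q) :* s := x :* (a :* q :* s) :+ b :* (x :* q) :* s) refl
        (ℕ→ℚ (e C u)) (ℕ→ℚ (e C suc u)) x (qpow x u) (sgn (e ∸ u))))
  hsum : sumFrom 0 (suc e) h ≡ - Q
  hsum = sym (trans (neg-distrib-sumFrom 0 (suc e) t) (sumFrom-cong 0 (suc e) _ _ (λ u _ u< →
    trans (neg-distribʳ-* (ℕ→ℚ (e C u) * qpow x u) (sgn (e ∸ u)))
     (cong (λ w → ℕ→ℚ (e C u) * qpow x u * sgn w) (sym (NP.+-∸-assoc 1 (NP.≤-pred u<)))))))

-- Summation by parts

negPow-pred : ∀ i z → negPow (suc i) (z ℤ.- + 1) ≡ negPow (suc i) z * ℕ→ℚ (suc i)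
negPow-pred i (+ zero) = solve 1 (λ x → x :* con 1ℚ := con 1ℚ :* x) refl (ℕ→ℚ (suc i))
negPow-pred i (+ suc k) = sym (trans (*-assoc (inv1+ i) _ _)
  (trans (cong (inv1+ i *_) (*-comm (qpow (inv1+ i) k) _))
  (trans (sym (*-assoc (inv1+ i) _ _)) (trans (cong (_* qpow (inv1+ i) k) (inv1+-inverse i)) (*-identityˡ _)))))
negPow-pred i -[1+ k ] = trans (cong (λ w → negPow (suc i) -[1+ w ]) (cong suc (NP.+-identityʳ k)))
  (*-comm (ℕ→ℚ (suc i)) _)

negPow-sub : ∀ i z u → negPow (suc i) (z ℤ.- + u) ≡ negPow (suc i) z * pow (suc i) u
negPow-sub i z zero = trans (cong (negPow (suc i)) (ZP.+-identityʳ z)) (sym (*-identityʳ _))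
negPow-sub i z (suc u) = trans (cong (negPow (suc i)) (sub-suc z u)) (trans (negPow-pred i (z ℤ.- + u))
  (trans (cong (_* ℕ→ℚ (suc i)) (negPow-sub i z u))
   (solve 3 (λ a b c → a :* b :* c := a :* (c :* b)) refl (negPow (suc i) z) (pow (suc i) u) (ℕ→ℚ (suc i)))))
  where
  sub-suc : ∀ z u → z ℤ.- + suc u ≡ (z ℤ.- + u) ℤ.- + 1
  sub-suc z u = trans (cong (λ w → z ℤ.- w) (ZP.pos-+ 1 u)) (ZS.solve 2 (λ a b → a ZS.:- (ZS.con (+ 1) ZS.:+ b) ZS.:= (a ZS.:- b) ZS.:- ZS.con (+ 1)) refl z (+ u))

harm-suc : ∀ z n → harm z (suc n) ≡ harm z n + negPow (suc n) z
harm-suc z n = sumFrom-snoc 1 n (λ j → negPow j z)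

z-m-u≡z-[m+u] : ∀ z m u → (z ℤ.- + m) ℤ.- + u ≡ z ℤ.- + (m ℕ.+ u)
z-m-u≡z-[m+u] z m u = trans (ZS.solve 3 (λ z a b → z ZS.:- a ZS.:- b ZS.:= z ZS.:- (a ZS.:+ b)) refl z (+ m) (+ u)) (cong (λ w → z ℤ.- w) (sym (ZP.pos-+ m u)))

sumPow*harm-byParts : (j : ℕ) (Φ : ℕ → ℚ) (U : ℕ) (ψ : ℕ → ℚ) →
  (∀ n → Φ (suc n) ≡ Φ n + pow (suc n) j) →
  (∀ n → Φ n ≡ sumFrom 0 U (λ u → ψ u * pow (suc n) u)) →
  ∀ (z : ℤ) n → sumFrom 0 (suc n) (λ ℓ → pow ℓ j * harm z ℓ)
     ≡ Φ n * harm z n - sumFrom 0 U (λ u → ψ u * harm (z ℤ.- + u) n)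
sumPow*harm-byParts j Φ U ψ Φ-suc Φ-expand z zero =
  trans (trans (+-identityʳ (pow 0 j * 0ℚ)) (*-zeroʳ (pow 0 j)))
    (sym (cong₂ _-_ (*-zeroʳ (Φ 0)) (sumFrom-zero 0 U _ (λ u _ _ → *-zeroʳ (ψ u)))))
sumPow*harm-byParts j Φ U ψ Φ-suc Φ-expand z (suc n) = begin
    sumFrom 0 (suc (suc n)) (λ ℓ → pow ℓ j * harm z ℓ)
  ≡⟨ sumFrom-snoc 0 (suc n) (λ ℓ → pow ℓ j * harm z ℓ) ⟩
    sumFrom 0 (suc n) (λ ℓ → pow ℓ j * harm z ℓ) + P * harm z (suc n)
  ≡⟨ cong (_+ P * harm z (suc n)) (sumPow*harm-byParts j Φ U ψ Φ-suc Φ-expand z n) ⟩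
    Φ n * harm z n - X + P * harm z (suc n)
  ≡⟨ cong (λ w → Φ n * harm z n - X + P * w) (harm-suc z n) ⟩
    Φ n * harm z n - X + P * (harm z n + e)
  ≡⟨ solve 5 (λ F P h e X → F :* h :- X :+ P :* (h :+ e) := (F :+ P) :* (h :+ e) :- (X :+ e :* F)) refl
       (Φ n) P (harm z n) e X ⟩
    (Φ n + P) * (harm z n + e) - (X + e * Φ n)
  ≡⟨ cong₂ (λ a c → a * c - (X + e * Φ n)) (sym (Φ-suc n)) (sym (harm-suc z n)) ⟩
    Φ (suc n) * harm z (suc n) - (X + e * Φ n)
  ≡⟨ cong (λ w → Φ (suc n) * harm z (suc n) - w) (sym correction-suc) ⟩
    Φ (suc n) * harm z (suc n) - sumFrom 0 U (λ u → ψ u * harm (z ℤ.- + u) (suc n)) ∎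
  where
  open ≡-Reasoning
  P = pow (suc n) j
  e = negPow (suc n) z
  X = sumFrom 0 U (λ u → ψ u * harm (z ℤ.- + u) n)
  correction-suc : sumFrom 0 U (λ u → ψ u * harm (z ℤ.- + u) (suc n)) ≡ X + e * Φ n
  correction-suc = begin
      sumFrom 0 U (λ u → ψ u * harm (z ℤ.- + u) (suc n))
    ≡⟨ sumFrom-cong 0 U _ _ (λ u _ _ → cong (ψ u *_)
         (trans (harm-suc (z ℤ.- + u) n) (cong (λ w → harm (z ℤ.- + u) n + w) (negPow-sub n z u)))) ⟩
      sumFrom 0 U (λ u → ψ u * (harm (z ℤ.- + u) n + e * pow (suc n) u))
    ≡⟨ trans (sumFrom-cong 0 U _ _ (λ u _ _ → *-distribˡ-+ (ψ u) _ _)) (sumFrom-+ 0 U _ _) ⟩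
      X + sumFrom 0 U (λ u → ψ u * (e * pow (suc n) u))
    ≡⟨ cong (λ w → X + w) (sumFrom-cong 0 U _ _ (λ u _ _ →
         solve 3 (λ a b c → a :* (b :* c) := b :* (a :* c)) refl (ψ u) e (pow (suc n) u))) ⟩
      X + sumFrom 0 U (λ u → e * (ψ u * pow (suc n) u))
    ≡⟨ cong (λ w → X + w) (trans (sym (*-distribˡ-sumFrom 0 U e _)) (cong (e *_) (sym (Φ-expand n)))) ⟩
      X + e * Φ n ∎

-- Stirling numbers and the power sums A

falling : ℚ → ℕ → ℚ
falling x zero = 1ℚ
falling x (suc m) = falling x m * (x - ℕ→ℚ m)

falling-suc′ : ∀ x m → falling x (suc m) ≡ x * falling (x - 1ℚ) m
falling-suc′ x zero = solve 1 (λ x → con 1ℚ :* (x :- con 0ℚ) := x :* con 1ℚ) refl x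
falling-suc′ x (suc m) = trans (cong (_* (x - ℕ→ℚ (suc m))) (falling-suc′ x m))
  (trans (cong (λ w → x * falling (x - 1ℚ) m * (x - w)) (ℕ→ℚ-suc m))
   (solve 4 (λ x f M o → x :* f :* (x :- (o :+ M)) := x :* (f :* (x :- o :- M))) refl x (falling (x - 1ℚ) m) (ℕ→ℚ m) 1ℚ))

k!*NCk≡falling : ∀ N k → ℕ→ℚ (k ! ℕ.* (N C k)) ≡ falling (ℕ→ℚ N) k
k!*NCk≡falling N zero = refl
k!*NCk≡falling zero (suc k) = trans (cong ℕ→ℚ (NP.*-zeroʳ (suc k !))) (sym (trans (falling-suc′ 0ℚ k) (*-zeroˡ (falling (0ℚ - 1ℚ) k))))
k!*NCk≡falling (suc N) (suc k) = begin
    ℕ→ℚ (suc k ! ℕ.* (suc N C suc k))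
  ≡⟨ cong (λ w → ℕ→ℚ (suc k ! ℕ.* w)) (sym (nCk+nC[k+1]≡[n+1]C[k+1] N k)) ⟩
    ℕ→ℚ (suc k ! ℕ.* (N C k ℕ.+ N C suc k))
  ≡⟨ cong ℕ→ℚ (*-distribˡ-+-assoc (suc k) (k !) (N C k) (N C suc k)) ⟩
    ℕ→ℚ (suc k ℕ.* (k ! ℕ.* (N C k)) ℕ.+ suc k ! ℕ.* (N C suc k))
  ≡⟨ trans (ℕ→ℚ-+ (suc k ℕ.* (k ! ℕ.* (N C k))) (suc k ! ℕ.* (N C suc k))) (cong₂ _+_ (ℕ→ℚ-* (suc k) (k ! ℕ.* (N C k))) refl) ⟩
    ℕ→ℚ (suc k) * ℕ→ℚ (k ! ℕ.* (N C k)) + ℕ→ℚ (suc k ! ℕ.* (N C suc k))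
  ≡⟨ cong₂ (λ a b → ℕ→ℚ (suc k) * a + b) (k!*NCk≡falling N k) (k!*NCk≡falling N (suc k)) ⟩
    ℕ→ℚ (suc k) * falling (ℕ→ℚ N) k + falling (ℕ→ℚ N) k * (ℕ→ℚ N - ℕ→ℚ k)
  ≡⟨ cong (λ w → w * falling (ℕ→ℚ N) k + falling (ℕ→ℚ N) k * (ℕ→ℚ N - ℕ→ℚ k)) (ℕ→ℚ-suc k) ⟩
    (1ℚ + ℕ→ℚ k) * falling (ℕ→ℚ N) k + falling (ℕ→ℚ N) k * (ℕ→ℚ N - ℕ→ℚ k)
  ≡⟨ solve 4 (λ o K f n → (o :+ K) :* f :+ f :* (n :- K) := (o :+ n) :* f) refl 1ℚ (ℕ→ℚ k) (falling (ℕ→ℚ N) k) (ℕ→ℚ N) ⟩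
    (1ℚ + ℕ→ℚ N) * falling (ℕ→ℚ N) k
  ≡⟨ cong (_* falling (ℕ→ℚ N) k) (sym (ℕ→ℚ-suc N)) ⟩
    ℕ→ℚ (suc N) * falling (ℕ→ℚ N) k
  ≡⟨ cong (λ w → ℕ→ℚ (suc N) * falling w k) (solve 1 (λ n → n := con 1ℚ :+ n :- con 1ℚ) refl (ℕ→ℚ N)) ⟩
    ℕ→ℚ (suc N) * falling (1ℚ + ℕ→ℚ N - 1ℚ) k
  ≡⟨ cong (λ w → ℕ→ℚ (suc N) * falling (w - 1ℚ) k) (sym (ℕ→ℚ-suc N)) ⟩
    ℕ→ℚ (suc N) * falling (ℕ→ℚ (suc N) - 1ℚ) k
  ≡⟨ sym (falling-suc′ (ℕ→ℚ (suc N)) k) ⟩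
    falling (ℕ→ℚ (suc N)) (suc k) ∎
  where
  open ≡-Reasoning
  *-distribˡ-+-assoc : ∀ s f a b → (s ℕ.* f) ℕ.* (a ℕ.+ b) ≡ s ℕ.* (f ℕ.* a) ℕ.+ (s ℕ.* f) ℕ.* b
  *-distribˡ-+-assoc s f a b = trans (NP.*-distribˡ-+ (s ℕ.* f) a b) (cong (ℕ._+ (s ℕ.* f) ℕ.* b) (NP.*-assoc s f a))

s₁-vanish : ∀ m t → m < t → s₁ m t ≡ + 0
s₁-vanish zero (suc t) _ = refl
s₁-vanish (suc m) (suc t) (s≤s m<t) rewrite s₁-vanish m t m<t | s₁-vanish m (suc t) (NP.m<n⇒m<1+n m<t) | ZP.*-zeroʳ (+ m) = refl

S₂-vanish : ∀ k i → k < i → S₂ k i ≡ + 0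
S₂-vanish zero (suc i) _ = refl
S₂-vanish (suc k) (suc i) (s≤s k<i) rewrite S₂-vanish k i k<i | S₂-vanish k (suc i) (NP.m<n⇒m<1+n k<i) | ZP.*-zeroʳ (+ suc i) = refl

s₁-suc-0 : ∀ i → s₁ (suc i) 0 ≡ + 0
s₁-suc-0 zero = refl
s₁-suc-0 (suc i) rewrite s₁-suc-0 i | ZP.*-zeroʳ (+ suc i) = refl

falling-s₁ : ∀ x m → falling x m ≡ sumFrom 0 (suc m) (λ t → ℤ→ℚ (s₁ m t) * qpow x t)
falling-s₁ x zero = solve 0 (con 1ℚ := con 1ℚ :* con 1ℚ :+ con 0ℚ) refl
falling-s₁ x (suc m) = sym (begin
    sumFrom 0 (suc (suc m)) (λ t → s' t * qpow x t)
  ≡⟨ sumFrom-head (suc m) (λ t → s' t * qpow x t) ⟩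
    s' 0 * 1ℚ + sumFrom 0 (suc m) (λ t → s' (suc t) * qpow x (suc t))
  ≡⟨ cong₂ (λ a b → a * 1ℚ + b) (trans (ℤ→ℚ-neg (+ m ℤ.* s₁ m 0)) (cong -_ (ℤ→ℚ-* (+ m) (s₁ m 0))))
       (sumFrom-cong 0 (suc m) _ _ (λ t _ _ → termeq t)) ⟩
    - (M * sm 0) * 1ℚ + sumFrom 0 (suc m) (λ t → x * (sm t * qpow x t) + (- M) * (sm (suc t) * qpow x (suc t)))
  ≡⟨ cong (λ w → - (M * sm 0) * 1ℚ + w) (trans (sumFrom-+ 0 (suc m) (λ t → x * (sm t * qpow x t)) (λ t → (- M) * (sm (suc t) * qpow x (suc t))))
        (cong₂ _+_ (sym (*-distribˡ-sumFrom 0 (suc m) x (λ t → sm t * qpow x t))) (sym (*-distribˡ-sumFrom 0 (suc m) (- M) (λ t → sm (suc t) * qpow x (suc t)))))) ⟩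
    - (M * sm 0) * 1ℚ + (x * T + (- M) * Y)
  ≡⟨ cong (λ w → - (M * sm 0) * 1ℚ + (x * T + (- M) * w)) tail-sum ⟩
    - (M * sm 0) * 1ℚ + (x * T + (- M) * (T - sm 0 * 1ℚ))
  ≡⟨ solve 4 (λ M s0 x T → :- (M :* s0) :* con 1ℚ :+ (x :* T :+ (:- M) :* (T :- s0 :* con 1ℚ)) := T :* (x :- M)) refl M (sm 0) x T ⟩
    T * (x - M)
  ≡⟨ cong (_* (x - M)) (sym (falling-s₁ x m)) ⟩
    falling x m * (x - M) ∎)
  where
  open ≡-Reasoning
  M = ℕ→ℚ m
  sm = λ t → ℤ→ℚ (s₁ m t)
  s' = λ t → ℤ→ℚ (s₁ (suc m) t)
  T = sumFrom 0 (suc m) (λ t → sm t * qpow x t)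
  Y = sumFrom 0 (suc m) (λ t → sm (suc t) * qpow x (suc t))
  termeq : ∀ t → s' (suc t) * qpow x (suc t) ≡ x * (sm t * qpow x t) + (- M) * (sm (suc t) * qpow x (suc t))
  termeq t = trans (cong (_* qpow x (suc t)) (trans (ℤ→ℚ-minus (s₁ m t) (+ m ℤ.* s₁ m (suc t))) (cong (λ w → sm t - w) (ℤ→ℚ-* (+ m) (s₁ m (suc t))))))
    (solve 5 (λ a M b x q → (a :- M :* b) :* (x :* q) := x :* (a :* q) :+ (:- M) :* (b :* (x :* q))) refl (sm t) M (sm (suc t)) x (qpow x t))
  tail-sum : Y ≡ T - sm 0 * 1ℚ
  tail-sum = begin
      Y
    ≡⟨ solve 2 (λ Y a → Y := a :+ Y :- a) refl Y (sm 0 * 1ℚ) ⟩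
      sm 0 * 1ℚ + Y - sm 0 * 1ℚ
    ≡⟨ cong (_- sm 0 * 1ℚ) (sym (sumFrom-head (suc m) (λ t → sm t * qpow x t))) ⟩
      sumFrom 0 (suc (suc m)) (λ t → sm t * qpow x t) - sm 0 * 1ℚ
    ≡⟨ cong (_- sm 0 * 1ℚ) (trans (sumFrom-snoc 0 (suc m) (λ t → sm t * qpow x t))
         (trans (cong (λ w → T + ℤ→ℚ w * qpow x (suc m)) (s₁-vanish m (suc m) (NP.n<1+n m)))
          (trans (cong (λ w → T + w) (*-zeroˡ (qpow x (suc m)))) (+-identityʳ T)))) ⟩
      T - sm 0 * 1ℚ ∎

qpow-S₂ : ∀ x k → qpow x k ≡ sumFrom 0 (suc k) (λ i → ℤ→ℚ (S₂ k i) * falling x i)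
qpow-S₂ x zero = solve 0 (con 1ℚ := con 1ℚ :* con 1ℚ :+ con 0ℚ) refl
qpow-S₂ x (suc k) = begin
    x * qpow x k
  ≡⟨ cong (x *_) (qpow-S₂ x k) ⟩
    x * sumFrom 0 (suc k) (λ i → Sk i * falling x i)
  ≡⟨ *-distribˡ-sumFrom 0 (suc k) x (λ i → Sk i * falling x i) ⟩
    sumFrom 0 (suc k) (λ i → x * (Sk i * falling x i))
  ≡⟨ sumFrom-cong 0 (suc k) _ _ (λ i _ _ → solve 4 (λ x s f I → x :* (s :* f) := s :* (f :* (x :- I)) :+ I :* s :* f) refl x (Sk i) (falling x i) (ℕ→ℚ i)) ⟩
    sumFrom 0 (suc k) (λ i → Sk i * falling x (suc i) + g i)
  ≡⟨ sumFrom-+ 0 (suc k) (λ i → Sk i * falling x (suc i)) g ⟩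
    sumFrom 0 (suc k) (λ i → Sk i * falling x (suc i)) + sumFrom 0 (suc k) g
  ≡⟨ cong (λ w → sumFrom 0 (suc k) (λ i → Sk i * falling x (suc i)) + w) reindex ⟩
    sumFrom 0 (suc k) (λ i → Sk i * falling x (suc i)) + sumFrom 0 (suc k) (λ i → g (suc i))
  ≡⟨ sym (sumFrom-+ 0 (suc k) (λ i → Sk i * falling x (suc i)) (λ i → g (suc i))) ⟩
    sumFrom 0 (suc k) (λ i → Sk i * falling x (suc i) + g (suc i))
  ≡⟨ sumFrom-cong 0 (suc k) _ _ (λ i _ _ → termeq i) ⟩
    sumFrom 0 (suc k) (λ i → S' (suc i) * falling x (suc i))
  ≡⟨ sym (+-identityˡ (sumFrom 0 (suc k) (λ i → S' (suc i) * falling x (suc i)))) ⟩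
    0ℚ + sumFrom 0 (suc k) (λ i → S' (suc i) * falling x (suc i))
  ≡⟨ cong (λ w → w + sumFrom 0 (suc k) (λ i → S' (suc i) * falling x (suc i))) (sym (*-zeroˡ 1ℚ)) ⟩
    S' 0 * falling x 0 + sumFrom 0 (suc k) (λ i → S' (suc i) * falling x (suc i))
  ≡⟨ sym (sumFrom-head (suc k) (λ i → S' i * falling x i)) ⟩
    sumFrom 0 (suc (suc k)) (λ i → S' i * falling x i) ∎
  where
  open ≡-Reasoning
  Sk = λ i → ℤ→ℚ (S₂ k i)
  S' = λ i → ℤ→ℚ (S₂ (suc k) i)
  g = λ i → ℕ→ℚ i * Sk i * falling x i
  reindex : sumFrom 0 (suc k) g ≡ sumFrom 0 (suc k) (λ i → g (suc i))
  reindex = begin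
      sumFrom 0 (suc k) g
    ≡⟨ sym (+-identityʳ (sumFrom 0 (suc k) g)) ⟩
      sumFrom 0 (suc k) g + 0ℚ
    ≡⟨ cong (λ w → sumFrom 0 (suc k) g + w) (sym (trans (cong (λ w → ℕ→ℚ (suc k) * ℤ→ℚ w * falling x (suc k)) (S₂-vanish k (suc k) (NP.n<1+n k)))
           (trans (cong (_* falling x (suc k)) (*-zeroʳ (ℕ→ℚ (suc k)))) (*-zeroˡ (falling x (suc k)))))) ⟩
      sumFrom 0 (suc k) g + g (suc k)
    ≡⟨ sym (sumFrom-snoc 0 (suc k) g) ⟩
      sumFrom 0 (suc (suc k)) g
    ≡⟨ sumFrom-head (suc k) g ⟩
      g 0 + sumFrom 0 (suc k) (λ i → g (suc i))
    ≡⟨ cong (_+ sumFrom 0 (suc k) (λ i → g (suc i))) (trans (cong (_* falling x 0) (*-zeroˡ (Sk 0))) (*-zeroˡ (falling x 0))) ⟩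
      0ℚ + sumFrom 0 (suc k) (λ i → g (suc i))
    ≡⟨ +-identityˡ (sumFrom 0 (suc k) (λ i → g (suc i))) ⟩
      sumFrom 0 (suc k) (λ i → g (suc i)) ∎
  termeq : ∀ i → Sk i * falling x (suc i) + g (suc i) ≡ S' (suc i) * falling x (suc i)
  termeq i = sym (trans (cong (_* falling x (suc i)) (trans (ℤ→ℚ-+ (+ suc i ℤ.* S₂ k (suc i)) (S₂ k i)) (cong (_+ Sk i) (ℤ→ℚ-* (+ suc i) (S₂ k (suc i))))))
    (solve 4 (λ I a b f → (I :* a :+ b) :* f := b :* f :+ I :* a :* f) refl (ℕ→ℚ (suc i)) (Sk (suc i)) (Sk i) (falling x (suc i))))

A-suc : ∀ k n → A k (suc n) ≡ A k n + pow (suc n) k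
A-suc k n = begin
    A k (suc n)
  ≡⟨ sumFrom-cong 0 (suc k) _ _ (λ i _ _ → termeq i) ⟩
    sumFrom 0 (suc k) (λ i → Sk i * ℕ→ℚ (i ! ℕ.* (suc n C suc i)) + Sk i * falling (ℕ→ℚ (suc n)) i)
  ≡⟨ sumFrom-+ 0 (suc k) (λ i → Sk i * ℕ→ℚ (i ! ℕ.* (suc n C suc i))) (λ i → Sk i * falling (ℕ→ℚ (suc n)) i) ⟩
    A k n + sumFrom 0 (suc k) (λ i → Sk i * falling (ℕ→ℚ (suc n)) i)
  ≡⟨ cong (λ w → A k n + w) (sym (qpow-S₂ (ℕ→ℚ (suc n)) k)) ⟩
    A k n + pow (suc n) k ∎
  where
  open ≡-Reasoning
  Sk = λ i → ℤ→ℚ (S₂ k i)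
  termeq : ∀ i → Sk i * ℕ→ℚ (i ! ℕ.* (suc (suc n) C suc i)) ≡ Sk i * ℕ→ℚ (i ! ℕ.* (suc n C suc i)) + Sk i * falling (ℕ→ℚ (suc n)) i
  termeq i = trans (cong (λ w → Sk i * ℕ→ℚ (i ! ℕ.* w)) (sym (trans (NP.+-comm (suc n C suc i) (suc n C i)) (nCk+nC[k+1]≡[n+1]C[k+1] (suc n) i))))
    (trans (cong (Sk i *_) (trans (cong ℕ→ℚ (NP.*-distribˡ-+ (i !) (suc n C suc i) (suc n C i))) (ℕ→ℚ-+ (i ! ℕ.* (suc n C suc i)) (i ! ℕ.* (suc n C i)))))
      (trans (*-distribˡ-+ (Sk i) _ _) (cong (λ w → Sk i * ℕ→ℚ (i ! ℕ.* (suc n C suc i)) + Sk i * w) (k!*NCk≡falling (suc n) i))))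

i!*NC[1+i]≡falling : ∀ N i → ℕ→ℚ (i ! ℕ.* (N C suc i)) ≡ inv1+ i * falling (ℕ→ℚ N) (suc i)
i!*NC[1+i]≡falling N i = sym (trans (cong (inv1+ i *_) (sym (k!*NCk≡falling N (suc i))))
  (trans (cong (λ w → inv1+ i * ℕ→ℚ w) (NP.*-assoc (suc i) (i !) (N C suc i)))
  (trans (cong (inv1+ i *_) (ℕ→ℚ-* (suc i) (i ! ℕ.* (N C suc i))))
  (trans (sym (*-assoc (inv1+ i) _ _)) (trans (cong (_* ℕ→ℚ (i ! ℕ.* (N C suc i))) (inv1+-inverse i)) (*-identityˡ _))))))

A-expand : ∀ k n → A k n ≡ sumFrom 0 (suc (suc k)) (λ u → Hs k u * pow (suc n) u)
A-expand k n = begin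
    A k n
  ≡⟨ sumFrom-cong 0 (suc k) _ _ (λ i _ i< → expand-i i (NP.≤-pred i<)) ⟩
    sumFrom 0 (suc k) (λ i → sumFrom 0 (suc (suc k)) (λ t → F i t))
  ≡⟨ sumFrom-swap 0 (suc k) 0 (suc (suc k)) F ⟩
    sumFrom 0 (suc (suc k)) (λ t → sumFrom 0 (suc k) (λ i → F i t))
  ≡⟨ sumFrom-cong 0 (suc (suc k)) _ _ (λ t _ t< → collect-t t (NP.≤-pred t<)) ⟩
    sumFrom 0 (suc (suc k)) (λ u → Hs k u * pow (suc n) u) ∎
  where
  open ≡-Reasoning
  x = ℕ→ℚ (suc n)
  F : ℕ → ℕ → ℚ
  F i t = inv1+ i * ℤ→ℚ (S₂ k i) * ℤ→ℚ (s₁ (suc i) t) * qpow x t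
  expand-i : ∀ i → i ≤ k → ℤ→ℚ (S₂ k i) * ℕ→ℚ (i ! ℕ.* (suc n C suc i)) ≡ sumFrom 0 (suc (suc k)) (λ t → F i t)
  expand-i i i≤k = begin
      ℤ→ℚ (S₂ k i) * ℕ→ℚ (i ! ℕ.* (suc n C suc i))
    ≡⟨ cong (ℤ→ℚ (S₂ k i) *_) (trans (i!*NC[1+i]≡falling (suc n) i) (cong (inv1+ i *_) (falling-s₁ x (suc i)))) ⟩
      ℤ→ℚ (S₂ k i) * (inv1+ i * sumFrom 0 (suc (suc i)) (λ t → ℤ→ℚ (s₁ (suc i) t) * qpow x t))
    ≡⟨ trans (sym (*-assoc (ℤ→ℚ (S₂ k i)) (inv1+ i) _)) (*-distribˡ-sumFrom 0 (suc (suc i)) (ℤ→ℚ (S₂ k i) * inv1+ i) (λ t → ℤ→ℚ (s₁ (suc i) t) * qpow x t)) ⟩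
      sumFrom 0 (suc (suc i)) (λ t → ℤ→ℚ (S₂ k i) * inv1+ i * (ℤ→ℚ (s₁ (suc i) t) * qpow x t))
    ≡⟨ sumFrom-cong 0 (suc (suc i)) _ _ (λ t _ _ → solve 4 (λ a b c d → a :* b :* (c :* d) := b :* a :* c :* d) refl (ℤ→ℚ (S₂ k i)) (inv1+ i) (ℤ→ℚ (s₁ (suc i) t)) (qpow x t)) ⟩
      sumFrom 0 (suc (suc i)) (λ t → F i t)
    ≡⟨ sym (sumFrom-extend 0 (suc (suc i)) (suc (suc k)) (λ t → F i t) (s≤s (s≤s i≤k))
          (λ t i+2≤t _ → trans (cong (λ w → inv1+ i * ℤ→ℚ (S₂ k i) * ℤ→ℚ w * qpow x t) (s₁-vanish (suc i) t i+2≤t))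
             (trans (cong (_* qpow x t) (*-zeroʳ (inv1+ i * ℤ→ℚ (S₂ k i)))) (*-zeroˡ (qpow x t))))) ⟩
      sumFrom 0 (suc (suc k)) (λ t → F i t) ∎
  collect-t : ∀ t → t ≤ suc k → sumFrom 0 (suc k) (λ i → F i t) ≡ Hs k t * qpow x t
  collect-t t t≤ = trans (sym (*-distribʳ-sumFrom 0 (suc k) (qpow x t) (λ i → inv1+ i * ℤ→ℚ (S₂ k i) * ℤ→ℚ (s₁ (suc i) t))))
    (cong (_* qpow x t) (sym (sumFrom-dropZeros (t ∸ 1) (suc k) _ (NP.≤-trans (NP.m∸n≤m t 1) t≤)
      (λ i i< → trans (cong (λ w → inv1+ i * ℤ→ℚ (S₂ k i) * ℤ→ℚ w) (s₁-vanish (suc i) t (lt i t i<))) (*-zeroʳ (inv1+ i * ℤ→ℚ (S₂ k i)))))))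
    where
    lt : ∀ i t → i < t ∸ 1 → suc i < t
    lt i (suc t) p = s≤s p

Hs-0 : ∀ k → Hs k 0 ≡ 0ℚ
Hs-0 k = sumFrom-zero 0 (suc k) (λ i → inv1+ i * ℤ→ℚ (S₂ k i) * ℤ→ℚ (s₁ (suc i) 0))
  (λ i _ _ → trans (cong (λ w → inv1+ i * ℤ→ℚ (S₂ k i) * ℤ→ℚ w) (s₁-suc-0 i)) (*-zeroʳ (inv1+ i * ℤ→ℚ (S₂ k i))))

Hs-vanish : ∀ k t → suc k < t → Hs k t ≡ 0ℚ
Hs-vanish k (suc t) (s≤s p) = cong (λ w → sumFrom t w (λ i → inv1+ i * ℤ→ℚ (S₂ k i) * ℤ→ℚ (s₁ (suc i) (suc t)))) (NP.m≤n⇒m∸n≡0 p)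

sumPow*harm-A : ∀ k z n → sumFrom 0 (suc n) (λ ℓ → pow ℓ k * harm z ℓ) ≡ A k n * harm z n - sumFrom 0 (suc (suc k)) (λ u → Hs k u * harm (z ℤ.- + u) n)
sumPow*harm-A k = sumPow*harm-byParts k (λ n → A k n) (suc (suc k)) (Hs k) (A-suc k) (A-expand k)

-- Bernoulli numbers and Faulhaber polynomials

bernTable-lookup : ∀ m i → i ≤ m → bernTable m i ≡ B⁺ i
bernTable-lookup zero zero _ = refl
bernTable-lookup (suc m) i i≤ with i ℕ.≤? m
... | yes p = bernTable-lookup m i p
... | no ¬p with NP.≤-antisym i≤ (NP.≰⇒> ¬p)
... | refl = sym (if-false (≤ᵇ-false {suc m} {m} (NP.<-irrefl refl)))

bernoulliSum : ℕ → ℚ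
bernoulliSum m = sumFrom 0 (suc m) (λ k → sgn k * ℕ→ℚ (m C k) * inv1+ k * B⁺ (m ∸ k))

bernoulliSum-suc : ∀ m → bernoulliSum (suc m) ≡ 0ℚ
bernoulliSum-suc m = begin
    bernoulliSum (suc m)
  ≡⟨ sumFrom-head (suc m) (λ k → sgn k * ℕ→ℚ (suc m C k) * inv1+ k * B⁺ (suc m ∸ k)) ⟩
    1ℚ * 1ℚ * 1ℚ * B⁺ (suc m) + S
  ≡⟨ cong (λ w → 1ℚ * 1ℚ * 1ℚ * w + S) B⁺-suc ⟩
    1ℚ * 1ℚ * 1ℚ * (- S) + S
  ≡⟨ solve 1 (λ S → con 1ℚ :* con 1ℚ :* con 1ℚ :* (:- S) :+ S := con 0ℚ) refl S ⟩
    0ℚ ∎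
  where
  open ≡-Reasoning
  S = sumFrom 0 (suc m) (λ k → sgn (suc k) * ℕ→ℚ (suc m C suc k) * inv1+ (suc k) * B⁺ (m ∸ k))
  B⁺-suc : B⁺ (suc m) ≡ - S
  B⁺-suc = trans (if-false (≤ᵇ-false {suc m} {m} (NP.<-irrefl refl)))
    (cong -_ (trans (sumFrom-suc 0 (suc m) (λ k → sgn k * ℕ→ℚ (suc m C k) * inv1+ k * bernTable m (suc m ∸ k))) (sumFrom-cong 0 (suc m) _ _ (λ k _ _ →
      cong (λ w → sgn (suc k) * ℕ→ℚ (suc m C suc k) * inv1+ (suc k) * w) (bernTable-lookup m (m ∸ k) (NP.m∸n≤m m k))))))

faulhaberCoeff : ℕ → ℕ → ℚ
faulhaberCoeff j ℓ = inv1+ j * ℕ→ℚ (suc j C (j ∸ ℓ)) * B⁺ (j ∸ ℓ)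

-- faulhaberPowCoeff j u is the coefficient of x^u in Φ_j(x).
faulhaberPowCoeff : ℕ → ℕ → ℚ
faulhaberPowCoeff j zero = 0ℚ
faulhaberPowCoeff j (suc ℓ) = faulhaberCoeff j ℓ

faulhaber : ℕ → ℕ → ℚ
faulhaber j n = sumFrom 0 (suc j) (λ ℓ → faulhaberCoeff j ℓ * pow n (suc ℓ))

-- shiftedCoeff j u is the coefficient of (n+1)^u in Φ_j(n), via n^{ℓ+1} = ((n+1) - 1)^{ℓ+1};
-- the paper's D(r,m,j,y) is shiftedCoeff j (m - y).
shiftedTerm : ℕ → ℕ → ℕ → ℚ
shiftedTerm j u ℓ = faulhaberCoeff j ℓ * ℕ→ℚ (suc ℓ C u) * sgn (suc ℓ ∸ u)

shiftedCoeff : ℕ → ℕ → ℚ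
shiftedCoeff j u = sumFrom 0 (suc j) (shiftedTerm j u)

shiftedTerm-vanish : ∀ j u ℓ → suc ℓ < u → shiftedTerm j u ℓ ≡ 0ℚ
shiftedTerm-vanish j u ℓ p = trans (cong (λ w → faulhaberCoeff j ℓ * ℕ→ℚ w * sgn (suc ℓ ∸ u)) (k>n⇒nCk≡0 p))
  (trans (cong (_* sgn (suc ℓ ∸ u)) (*-zeroʳ (faulhaberCoeff j ℓ))) (*-zeroˡ (sgn (suc ℓ ∸ u))))

shiftedCoeff-vanish : ∀ j u → suc j < u → shiftedCoeff j u ≡ 0ℚ
shiftedCoeff-vanish j u p = sumFrom-zero 0 (suc j) (shiftedTerm j u) (λ ℓ _ ℓ< → shiftedTerm-vanish j u ℓ (NP.<-≤-trans (s≤s ℓ<) p))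

shiftedCoeff-init : ∀ j u' → sumFrom 0 (suc u') (shiftedTerm j (suc u')) ≡ faulhaberCoeff j u'
shiftedCoeff-init j u' = trans (sumFrom-snoc 0 u' (shiftedTerm j (suc u')))
  (trans (cong₂ _+_ (sumFrom-zero 0 u' (shiftedTerm j (suc u')) (λ ℓ _ ℓ< → shiftedTerm-vanish j (suc u') ℓ (s≤s ℓ<))) last)
   (+-identityˡ (faulhaberCoeff j u')))
  where
  last : shiftedTerm j (suc u') u' ≡ faulhaberCoeff j u'
  last = trans (cong₂ (λ a b → faulhaberCoeff j u' * ℕ→ℚ a * sgn b) (nCn≡1 (suc u')) (NP.n∸n≡0 u'))
    (solve 1 (λ x → x :* con 1ℚ :* con 1ℚ := x) refl (faulhaberCoeff j u'))

shiftedCoeff-top : ∀ j → shiftedCoeff j (suc j) ≡ faulhaberCoeff j j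
shiftedCoeff-top j = shiftedCoeff-init j j

tailFactor : ℕ → ℕ → ℚ
tailFactor u m = inv1+ (u ℕ.+ m) * ℕ→ℚ (suc (u ℕ.+ m) C u) * ℕ→ℚ (suc m)

shiftedTerm-tail : ∀ u k a → shiftedTerm (u ℕ.+ (k ℕ.+ a)) u (u ℕ.+ k)
             ≡ - (tailFactor u (k ℕ.+ a) * (sgn k * ℕ→ℚ ((k ℕ.+ a) C k) * inv1+ k * B⁺ a))
shiftedTerm-tail u k a = begin
    inv1+ j * ℕ→ℚ (suc j C (j ∸ (u ℕ.+ k))) * B⁺ (j ∸ (u ℕ.+ k)) * ℕ→ℚ (suc (u ℕ.+ k) C u) * sgn (suc (u ℕ.+ k) ∸ u)
  ≡⟨ cong₂ (λ d e → inv1+ j * ℕ→ℚ (suc j C d) * B⁺ d * ℕ→ℚ (suc (u ℕ.+ k) C u) * sgn e) jl sl ⟩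
    inv1+ j * ℕ→ℚ (suc j C a) * B⁺ a * ℕ→ℚ (suc (u ℕ.+ k) C u) * - sgn k
  ≡⟨ cong₂ (λ p q → inv1+ j * ℕ→ℚ (p C a) * B⁺ a * ℕ→ℚ (q C u) * - sgn k) e1 (sym (NP.+-suc u k)) ⟩
    inv1+ j * C1 * B⁺ a * C2 * - sgn k
  ≡⟨ solve 5 (λ i C1 B C2 s → i :* C1 :* B :* C2 :* (:- s) := :- (i :* B :* s :* (C1 :* C2))) refl (inv1+ j) C1 (B⁺ a) C2 (sgn k) ⟩
    - (inv1+ j * B⁺ a * sgn k * (C1 * C2))
  ≡⟨ cong (λ w → - (inv1+ j * B⁺ a * sgn k * w)) prod ⟩
    - (inv1+ j * B⁺ a * sgn k * (inv1+ k * (ℕ→ℚ (suc (k ℕ.+ a)) * C3 * C4)))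
  ≡⟨ cong -_ (solve 7 (λ i B s ik M C3 C4 → i :* B :* s :* (ik :* (M :* C3 :* C4)) := i :* C3 :* M :* (s :* C4 :* ik :* B)) refl
        (inv1+ j) (B⁺ a) (sgn k) (inv1+ k) (ℕ→ℚ (suc (k ℕ.+ a))) C3 C4) ⟩
    - (inv1+ j * C3 * ℕ→ℚ (suc (k ℕ.+ a)) * (sgn k * C4 * inv1+ k * B⁺ a))
  ≡⟨ cong (λ w → - (inv1+ j * ℕ→ℚ (w C u) * ℕ→ℚ (suc (k ℕ.+ a)) * (sgn k * C4 * inv1+ k * B⁺ a))) (NP.+-suc u (k ℕ.+ a)) ⟩
    - (tailFactor u (k ℕ.+ a) * (sgn k * ℕ→ℚ ((k ℕ.+ a) C k) * inv1+ k * B⁺ a)) ∎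
  where
  open ≡-Reasoning
  j = u ℕ.+ (k ℕ.+ a)
  C1 = ℕ→ℚ ((a ℕ.+ (u ℕ.+ suc k)) C a)
  C2 = ℕ→ℚ ((u ℕ.+ suc k) C u)
  C3 = ℕ→ℚ ((u ℕ.+ suc (k ℕ.+ a)) C u)
  C4 = ℕ→ℚ ((k ℕ.+ a) C k)
  jl : j ∸ (u ℕ.+ k) ≡ a
  jl = trans (NP.[m+n]∸[m+o]≡n∸o u (k ℕ.+ a) k) (NP.m+n∸m≡n k a)
  sl : suc (u ℕ.+ k) ∸ u ≡ suc k
  sl = trans (cong (_∸ u) (sym (NP.+-suc u k))) (NP.m+n∸m≡n u (suc k))
  e1 : suc j ≡ a ℕ.+ (u ℕ.+ suc k)
  e1 = NS.solve 3 (λ u k a → NS.con 1 NS.:+ (u NS.:+ (k NS.:+ a)) NS.:= a NS.:+ (u NS.:+ (NS.con 1 NS.:+ k))) refl u k a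
  prod : C1 * C2 ≡ inv1+ k * (ℕ→ℚ (suc (k ℕ.+ a)) * C3 * C4)
  c1 = (a ℕ.+ (u ℕ.+ suc k)) C a
  c2 = (u ℕ.+ suc k) C u
  c3 = (u ℕ.+ suc (k ℕ.+ a)) C u
  c4 = (k ℕ.+ a) C k
  prod = begin
      C1 * C2
    ≡⟨ sym (ℕ→ℚ-* c1 c2) ⟩
      ℕ→ℚ (c1 ℕ.* c2)
    ≡⟨ sym (trans (cong (_* ℕ→ℚ (c1 ℕ.* c2)) (inv1+-inverse k)) (*-identityˡ (ℕ→ℚ (c1 ℕ.* c2)))) ⟩
      inv1+ k * ℕ→ℚ (suc k) * ℕ→ℚ (c1 ℕ.* c2)
    ≡⟨ trans (*-assoc (inv1+ k) (ℕ→ℚ (suc k)) (ℕ→ℚ (c1 ℕ.* c2))) (cong (inv1+ k *_) (sym (ℕ→ℚ-* (suc k) (c1 ℕ.* c2)))) ⟩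
      inv1+ k * ℕ→ℚ (suc k ℕ.* (c1 ℕ.* c2))
    ≡⟨ cong (λ w → inv1+ k * ℕ→ℚ w) (binomial-product u k a) ⟩
      inv1+ k * ℕ→ℚ (suc (k ℕ.+ a) ℕ.* (c3 ℕ.* c4))
    ≡⟨ cong (inv1+ k *_) (trans (ℕ→ℚ-* (suc (k ℕ.+ a)) (c3 ℕ.* c4)) (trans (cong (ℕ→ℚ (suc (k ℕ.+ a)) *_) (ℕ→ℚ-* c3 c4)) (sym (*-assoc (ℕ→ℚ (suc (k ℕ.+ a))) C3 C4)))) ⟩
      inv1+ k * (ℕ→ℚ (suc (k ℕ.+ a)) * C3 * C4) ∎

shiftedCoeff-initSum : ∀ j u → sumFrom 0 u (shiftedTerm j u) ≡ faulhaberPowCoeff j u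
shiftedCoeff-initSum j zero = refl
shiftedCoeff-initSum j (suc u') = shiftedCoeff-init j u'

-- The terms ℓ ≥ u of ψ_{u+m}(u) add up to a multiple of the Bernoulli recurrence,
-- which vanishes unless m = 0.
shiftedCoeff-split : ∀ u m → shiftedCoeff (u ℕ.+ m) u ≡ faulhaberPowCoeff (u ℕ.+ m) u - tailFactor u m * bernoulliSum m
shiftedCoeff-split u m = begin
    sumFrom 0 (suc (u ℕ.+ m)) f
  ≡⟨ cong (λ w → sumFrom 0 w f) (sym (NP.+-suc u m)) ⟩
    sumFrom 0 (u ℕ.+ suc m) f
  ≡⟨ sumFrom-split 0 u (suc m) f ⟩
    sumFrom 0 u f + sumFrom u (suc m) f
  ≡⟨ cong₂ _+_ (shiftedCoeff-initSum (u ℕ.+ m) u) (sumFrom-offset u (suc m) f) ⟩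
    faulhaberPowCoeff (u ℕ.+ m) u + sumFrom 0 (suc m) (λ k → f (u ℕ.+ k))
  ≡⟨ cong (λ w → faulhaberPowCoeff (u ℕ.+ m) u + w) (sumFrom-cong 0 (suc m) _ _ (λ k _ k< → tail-term k (NP.≤-pred k<))) ⟩
    faulhaberPowCoeff (u ℕ.+ m) u + sumFrom 0 (suc m) (λ k → - (tailFactor u m * T k))
  ≡⟨ cong (λ w → faulhaberPowCoeff (u ℕ.+ m) u + w) (trans (sym (neg-distrib-sumFrom 0 (suc m) (λ k → tailFactor u m * T k))) (cong -_ (sym (*-distribˡ-sumFrom 0 (suc m) (tailFactor u m) T)))) ⟩
    faulhaberPowCoeff (u ℕ.+ m) u - tailFactor u m * bernoulliSum m ∎
  where
  open ≡-Reasoning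
  f = shiftedTerm (u ℕ.+ m) u
  T = λ k → sgn k * ℕ→ℚ (m C k) * inv1+ k * B⁺ (m ∸ k)
  tail-term : ∀ k → k ≤ m → f (u ℕ.+ k) ≡ - (tailFactor u m * T k)
  tail-term k k≤m = subst (λ w → shiftedTerm (u ℕ.+ w) u (u ℕ.+ k) ≡ - (tailFactor u w * (sgn k * ℕ→ℚ (w C k) * inv1+ k * B⁺ (m ∸ k))))
    (NP.m+[n∸m]≡n k≤m) (shiftedTerm-tail u k (m ∸ k))

shiftedCoeff-offDiag : ∀ j u → u ≤ suc j → u ≢ j → shiftedCoeff j u ≡ faulhaberPowCoeff j u
shiftedCoeff-offDiag j u u≤ u≢j with u ℕ.≟ suc j
... | yes refl = shiftedCoeff-top j
... | no u≢sj = subst (λ w → shiftedCoeff w u ≡ faulhaberPowCoeff w u) (NP.m+[n∸m]≡n u≤j) (cases (j ∸ u) (λ e → u≢j (sym (trans (sym (NP.m+[n∸m]≡n u≤j)) (trans (cong (u ℕ.+_) e) (NP.+-identityʳ u))))))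
  where
  u≤j : u ≤ j
  u≤j = NP.≤-pred (NP.≤∧≢⇒< u≤ u≢sj)
  cases : ∀ m → m ≢ 0 → shiftedCoeff (u ℕ.+ m) u ≡ faulhaberPowCoeff (u ℕ.+ m) u
  cases zero ne = ⊥-elim (ne refl)
  cases (suc m) _ = trans (shiftedCoeff-split u (suc m)) (trans (cong (λ w → faulhaberPowCoeff (u ℕ.+ suc m) u - tailFactor u (suc m) * w) (bernoulliSum-suc m))
    (solve 2 (λ a b → a :- b :* con 0ℚ := a) refl (faulhaberPowCoeff (u ℕ.+ suc m) u) (tailFactor u (suc m))))

tailFactor-diag : ∀ j → tailFactor j 0 ≡ 1ℚ
tailFactor-diag j = trans (cong (λ w → inv1+ w * ℕ→ℚ (suc w C j) * 1ℚ) (NP.+-identityʳ j))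
  (trans (cong (λ w → inv1+ j * ℕ→ℚ w * 1ℚ) (trans (nCk≡nC[n∸k] (NP.n≤1+n j)) (trans (cong (suc j C_) (NP.m+n∸n≡m 1 j)) (nC1≡n (suc j)))))
   (trans (*-identityʳ _) (inv1+-inverse j)))

shiftedCoeff-diag : ∀ j → shiftedCoeff j j + 1ℚ ≡ faulhaberPowCoeff j j
shiftedCoeff-diag j = subst (λ w → shiftedCoeff w j + 1ℚ ≡ faulhaberPowCoeff w j) (NP.+-identityʳ j)
  (trans (cong (_+ 1ℚ) (trans (shiftedCoeff-split j 0) (cong (λ w → faulhaberPowCoeff (j ℕ.+ 0) j - w * 1ℚ) (tailFactor-diag j))))
    (solve 1 (λ a → a :- con 1ℚ :* con 1ℚ :+ con 1ℚ := a) refl (faulhaberPowCoeff (j ℕ.+ 0) j)))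

faulhaber-shifted : ∀ j n → faulhaber j n ≡ sumFrom 0 (suc (suc j)) (λ u → shiftedCoeff j u * pow (suc n) u)
faulhaber-shifted j n = begin
    faulhaber j n
  ≡⟨ sumFrom-cong 0 (suc j) _ _ (λ ℓ _ ℓ< → step ℓ (NP.≤-pred ℓ<)) ⟩
    sumFrom 0 (suc j) (λ ℓ → sumFrom 0 (suc (suc j)) (λ u → shiftedTerm j u ℓ * qpow X u))
  ≡⟨ sumFrom-swap 0 (suc j) 0 (suc (suc j)) (λ ℓ u → shiftedTerm j u ℓ * qpow X u) ⟩
    sumFrom 0 (suc (suc j)) (λ u → sumFrom 0 (suc j) (λ ℓ → shiftedTerm j u ℓ * qpow X u))
  ≡⟨ sumFrom-cong 0 (suc (suc j)) _ _ (λ u _ _ → sym (*-distribʳ-sumFrom 0 (suc j) (qpow X u) (shiftedTerm j u))) ⟩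
    sumFrom 0 (suc (suc j)) (λ u → shiftedCoeff j u * pow (suc n) u) ∎
  where
  open ≡-Reasoning
  X = ℕ→ℚ (suc n)
  nX : ℕ→ℚ n ≡ X - 1ℚ
  nX = trans (solve 1 (λ x → x := con 1ℚ :+ x :- con 1ℚ) refl (ℕ→ℚ n)) (cong (_- 1ℚ) (sym (ℕ→ℚ-suc n)))
  binomialTerm = λ ℓ u → ℕ→ℚ (suc ℓ C u) * qpow X u * sgn (suc ℓ ∸ u)
  step : ∀ ℓ → ℓ ≤ j → faulhaberCoeff j ℓ * pow n (suc ℓ) ≡ sumFrom 0 (suc (suc j)) (λ u → shiftedTerm j u ℓ * qpow X u)
  step ℓ ℓ≤j = begin
      faulhaberCoeff j ℓ * qpow (ℕ→ℚ n) (suc ℓ)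
    ≡⟨ cong (λ w → faulhaberCoeff j ℓ * qpow w (suc ℓ)) nX ⟩
      faulhaberCoeff j ℓ * qpow (X - 1ℚ) (suc ℓ)
    ≡⟨ cong (faulhaberCoeff j ℓ *_) (qpow-pred-binomial X (suc ℓ)) ⟩
      faulhaberCoeff j ℓ * sumFrom 0 (suc (suc ℓ)) (binomialTerm ℓ)
    ≡⟨ cong (faulhaberCoeff j ℓ *_) (sym (sumFrom-extend 0 (suc (suc ℓ)) (suc (suc j)) (binomialTerm ℓ) (s≤s (s≤s ℓ≤j))
         (λ u p _ → trans (cong (λ w → ℕ→ℚ w * qpow X u * sgn (suc ℓ ∸ u)) (k>n⇒nCk≡0 p))
            (trans (cong (_* sgn (suc ℓ ∸ u)) (*-zeroˡ (qpow X u))) (*-zeroˡ (sgn (suc ℓ ∸ u))))))) ⟩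
      faulhaberCoeff j ℓ * sumFrom 0 (suc (suc j)) (binomialTerm ℓ)
    ≡⟨ *-distribˡ-sumFrom 0 (suc (suc j)) (faulhaberCoeff j ℓ) (binomialTerm ℓ) ⟩
      sumFrom 0 (suc (suc j)) (λ u → faulhaberCoeff j ℓ * binomialTerm ℓ u)
    ≡⟨ sumFrom-cong 0 (suc (suc j)) _ _ (λ u _ _ → solve 4 (λ c C q s → c :* (C :* q :* s) := c :* C :* s :* q) refl (faulhaberCoeff j ℓ) (ℕ→ℚ (suc ℓ C u)) (qpow X u) (sgn (suc ℓ ∸ u))) ⟩
      sumFrom 0 (suc (suc j)) (λ u → shiftedTerm j u ℓ * qpow X u) ∎

-- Both sides are polynomials in n + 1, with coefficients faulhaberPowCoeff and shiftedCoeff;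
-- these agree except in degree j, where they differ by 1.
faulhaber-suc : ∀ j n → faulhaber j (suc n) ≡ faulhaber j n + pow (suc n) j
faulhaber-suc j n = begin
    faulhaber j (suc n)
  ≡⟨ sym (+-identityˡ (faulhaber j (suc n))) ⟩
    0ℚ + faulhaber j (suc n)
  ≡⟨ cong (_+ faulhaber j (suc n)) (sym (*-zeroˡ 1ℚ)) ⟩
    faulhaberPowCoeff j 0 * qpow X 0 + faulhaber j (suc n)
  ≡⟨ sym (sumFrom-head (suc j) (λ u → faulhaberPowCoeff j u * qpow X u)) ⟩
    sumFrom 0 (suc (suc j)) (λ u → faulhaberPowCoeff j u * qpow X u)
  ≡⟨ sumFrom-cong 0 (suc (suc j)) _ _ (λ u _ _ → solve 2 (λ a b → a := b :+ (a :- b)) refl (faulhaberPowCoeff j u * qpow X u) (shiftedCoeff j u * qpow X u)) ⟩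
    sumFrom 0 (suc (suc j)) (λ u → shiftedCoeff j u * qpow X u + e u)
  ≡⟨ sumFrom-+ 0 (suc (suc j)) (λ u → shiftedCoeff j u * qpow X u) e ⟩
    sumFrom 0 (suc (suc j)) (λ u → shiftedCoeff j u * qpow X u) + sumFrom 0 (suc (suc j)) e
  ≡⟨ cong₂ _+_ (sym (faulhaber-shifted j n)) coeff-difference ⟩
    faulhaber j n + pow (suc n) j ∎
  where
  open ≡-Reasoning
  X = ℕ→ℚ (suc n)
  e = λ u → faulhaberPowCoeff j u * qpow X u - shiftedCoeff j u * qpow X u
  coeff-difference : sumFrom 0 (suc (suc j)) e ≡ qpow X j
  coeff-difference = trans (sumFrom-single 0 (suc (suc j)) e j z≤n (NP.m≤n⇒m≤1+n (NP.n<1+n j))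
    (λ i _ i< i≢j → trans (cong (λ w → w * qpow X i - shiftedCoeff j i * qpow X i) (sym (shiftedCoeff-offDiag j i (NP.≤-pred i<) i≢j)))
       (solve 1 (λ a → a :- a := con 0ℚ) refl (shiftedCoeff j i * qpow X i))))
    (trans (cong (λ w → w * qpow X j - shiftedCoeff j j * qpow X j) (sym (shiftedCoeff-diag j)))
      (solve 2 (λ p q → (p :+ con 1ℚ) :* q :- p :* q := q) refl (shiftedCoeff j j) (qpow X j)))

sumPow*harm-faulhaber : ∀ j z n → sumFrom 0 (suc n) (λ ℓ → pow ℓ j * harm z ℓ) ≡ faulhaber j n * harm z n - sumFrom 0 (suc (suc j)) (λ u → shiftedCoeff j u * harm (z ℤ.- + u) n)
sumPow*harm-faulhaber j = sumPow*harm-byParts j (faulhaber j) (suc (suc j)) (shiftedCoeff j) (faulhaber-suc j) (faulhaber-shifted j)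

-- The coefficients â and the expansion of hyperharmonic numbers

â-vanish : ∀ R m j → R ≤ m ℕ.+ j → â R m j ≡ 0ℚ
â-vanish zero m j _ = refl
â-vanish (suc zero) (suc m) j _ = refl
â-vanish (suc zero) zero (suc j) _ = refl
â-vanish (suc zero) zero zero ()
â-vanish (suc (suc r)) m zero p =
  trans (if-false (≡ᵇ-false {m} {suc r} (λ e → NP.<-irrefl refl (subst (λ w → suc (suc r) ≤ w) e p'))))
        (if-false (≤ᵇ-false {suc m} {suc r} (λ q → NP.<-irrefl refl (NP.≤-trans p' (NP.≤-pred (NP.m≤n⇒m≤1+n q))))))
  where p' : suc (suc r) ≤ m
        p' = subst (λ w → suc (suc r) ≤ w) (NP.+-identityʳ m) p
â-vanish (suc (suc r)) m (suc ℓ) p with suc m ℕ.≤? suc r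
... | no q = refl
... | yes q = if-false (≤ᵇ-false {suc ℓ} {suc r ∸ m} λ h →
       NP.<-irrefl refl (NP.≤-trans p
         (NP.≤-trans (NP.+-monoʳ-≤ m h) (NP.≤-reflexive (NP.m+[n∸m]≡n (NP.≤-trans (NP.n≤1+n m) q))))))

â-vanish′ : ∀ R m j → R ∸ m ≤ j → â R m j ≡ 0ℚ
â-vanish′ R m j p = â-vanish R m j (NP.≤-trans (NP.m≤n+m∸n R m) (NP.+-monoʳ-≤ m p))

∸1≤⇒≤suc : ∀ u ℓ → u ∸ 1 ≤ ℓ → u ≤ suc ℓ
∸1≤⇒≤suc zero ℓ _ = z≤n
∸1≤⇒≤suc (suc u) ℓ p = s≤s p

<∸1⇒suc< : ∀ u ℓ → ℓ < u ∸ 1 → suc ℓ < u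
<∸1⇒suc< (suc u) ℓ p = s≤s p

D-sign : ∀ ℓ M y → y ≤ M → M ∸ y ≤ suc ℓ →
  ℤ→ℚ ((ℤ.-1ℤ) ℤ.^ ℤ.∣ (+ 1) ℤ.+ (+ ℓ) ℤ.- (+ M) ℤ.+ (+ y) ∣) ≡ sgn (suc ℓ ∸ (M ∸ y))
D-sign ℓ M y y≤M u≤ = trans (cong (λ z → ℤ→ℚ ((ℤ.-1ℤ) ℤ.^ ℤ.∣ z ∣)) zeq) (ℤ→ℚ-[-1]^ w)
  where
  u = M ∸ y
  w = suc ℓ ∸ u
  e1 : + 1 ℤ.+ + ℓ ≡ + u ℤ.+ + w
  e1 = trans (sym (ZP.pos-+ 1 ℓ)) (trans (cong +_ (sym (NP.m+[n∸m]≡n u≤))) (ZP.pos-+ u w))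
  e2 : + M ≡ + y ℤ.+ + u
  e2 = trans (cong +_ (sym (NP.m+[n∸m]≡n y≤M))) (ZP.pos-+ y u)
  zeq : (+ 1) ℤ.+ (+ ℓ) ℤ.- (+ M) ℤ.+ (+ y) ≡ + w
  zeq = trans (cong₂ (λ a b → a ℤ.- b ℤ.+ (+ y)) e1 e2)
    (ZS.solve 3 (λ U W Y → U ZS.:+ W ZS.:- (Y ZS.:+ U) ZS.:+ Y ZS.:= W) refl (+ u) (+ w) (+ y))

D≡shiftedCoeff : ∀ R M j y → y ≤ M → D R M j y ≡ shiftedCoeff j (M ∸ y)
D≡shiftedCoeff R M j y y≤M = cases ((M ∸ y ∸ 1) ℕ.≤? suc j)
  where
  u = M ∸ y
  D-term : ℕ → ℚ
  D-term ℓ = faulhaberCoeff j ℓ * ℕ→ℚ (suc ℓ C u) * ℤ→ℚ ((ℤ.-1ℤ) ℤ.^ ℤ.∣ (+ 1) ℤ.+ (+ ℓ) ℤ.- (+ M) ℤ.+ (+ y) ∣)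
  D-unfold : D R M j y ≡ sumFrom (u ∸ 1) (suc j ∸ (u ∸ 1)) D-term
  D-unfold = refl
  cases : Dec (u ∸ 1 ≤ suc j) → D R M j y ≡ shiftedCoeff j u
  cases (yes p) = trans D-unfold (trans (sumFrom-cong (u ∸ 1) (suc j ∸ (u ∸ 1)) D-term (shiftedTerm j u) (λ ℓ a≤ℓ _ →
                 cong (λ s → faulhaberCoeff j ℓ * ℕ→ℚ (suc ℓ C u) * s) (D-sign ℓ M y y≤M (∸1≤⇒≤suc u ℓ a≤ℓ))))
              (sumFrom-dropZeros (u ∸ 1) (suc j) (shiftedTerm j u) p (λ ℓ ℓ< → shiftedTerm-vanish j u ℓ (<∸1⇒suc< u ℓ ℓ<))))
  cases (no ¬p) = trans D-unfold (trans (cong (λ w → sumFrom (u ∸ 1) w D-term) (NP.m≤n⇒m∸n≡0 (NP.<⇒≤ (NP.≰⇒> ¬p))))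
              (sym (shiftedCoeff-vanish j u (NP.<-trans (NP.n<1+n (suc j)) (<∸1⇒suc< u (suc j) (NP.≰⇒> ¬p))))))

â-suc-suc : ∀ r' m ℓ → ℓ < suc r' →
  â (suc (suc r')) m (suc ℓ) ≡ sumFrom ℓ (suc r' ∸ ℓ) (λ j → â (suc r') m j * faulhaberCoeff j ℓ)
â-suc-suc r' m ℓ ℓ<R = cases-m (suc m ℕ.≤? suc r')
  where
  open ≡-Reasoning
  g g' : ℕ → ℚ
  g j = â (suc r') m j * inv1+ j * ℕ→ℚ (suc j C (j ∸ ℓ)) * B⁺ (j ∸ ℓ)
  g' j = â (suc r') m j * faulhaberCoeff j ℓ
  S : ℚ
  S = sumFrom ℓ (suc r' ∸ ℓ) g'
  window-sum : suc m ≤ suc r' → suc ℓ ≤ suc r' ∸ m → sumFrom ℓ (suc (r' ∸ m) ∸ ℓ) g ≡ S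
  window-sum q q2 = begin
      sumFrom ℓ (suc (r' ∸ m) ∸ ℓ) g
    ≡⟨ cong (λ w → sumFrom ℓ (w ∸ ℓ) g) (sym (NP.+-∸-assoc 1 (NP.≤-pred q))) ⟩
      sumFrom ℓ ((suc r' ∸ m) ∸ ℓ) g
    ≡⟨ sumFrom-cong ℓ ((suc r' ∸ m) ∸ ℓ) g g' (λ j _ _ → solve 4 (λ a b d e → a :* b :* d :* e := a :* (b :* d :* e)) refl (â (suc r') m j) (inv1+ j) (ℕ→ℚ (suc j C (j ∸ ℓ))) (B⁺ (j ∸ ℓ))) ⟩
      sumFrom ℓ ((suc r' ∸ m) ∸ ℓ) g'
    ≡⟨ sym (sumFrom-extend ℓ ((suc r' ∸ m) ∸ ℓ) (suc r' ∸ ℓ) g' (NP.∸-monoˡ-≤ ℓ (NP.m∸n≤m (suc r') m))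
          (λ j p _ → trans (cong (_* faulhaberCoeff j ℓ) (â-vanish′ (suc r') m j (NP.≤-trans (NP.≤-reflexive (sym (NP.m+[n∸m]≡n ℓ≤))) p))) (*-zeroˡ (faulhaberCoeff j ℓ)))) ⟩
      S ∎
    where
    ℓ≤ : ℓ ≤ suc r' ∸ m
    ℓ≤ = NP.≤-trans (NP.n≤1+n ℓ) q2
  cases-ℓ : suc m ≤ suc r' → Dec (suc ℓ ≤ suc r' ∸ m) → â (suc (suc r')) m (suc ℓ) ≡ S
  cases-ℓ q (no q2) = trans (if-false (∧-falseʳ (≤ᵇ-true q) (≤ᵇ-false q2))) (sym (sumFrom-zero ℓ (suc r' ∸ ℓ) g' (λ j ℓ≤j _ → trans (cong (_* faulhaberCoeff j ℓ) (â-vanish′ (suc r') m j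
          (NP.≤-trans (NP.≤-pred (NP.≰⇒> q2)) ℓ≤j))) (*-zeroˡ (faulhaberCoeff j ℓ)))))
  cases-ℓ q (yes q2) = trans (if-true (∧-true (≤ᵇ-true q) (≤ᵇ-true q2))) (window-sum q q2)
  cases-m : Dec (suc m ≤ suc r') → â (suc (suc r')) m (suc ℓ) ≡ S
  cases-m (no q) = trans (if-false (∧-falseˡ (≤ᵇ-false q))) (sym (sumFrom-zero ℓ (suc r' ∸ ℓ) g' (λ j ℓ≤j _ → trans (cong (_* faulhaberCoeff j ℓ) (â-vanish (suc r') m j
          (NP.≤-trans (NP.≤-pred (NP.≰⇒> q)) (NP.m≤m+n m j)))) (*-zeroˡ (faulhaberCoeff j ℓ)))))
  cases-m (yes q) = cases-ℓ q (suc ℓ ℕ.≤? (suc r' ∸ m))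

correctionWeight : ℕ → ℕ → ℕ → ℕ → ℚ
correctionWeight R m j u = â R m j * shiftedCoeff j u

correctionWeight-vanish : ∀ R m j u → R < m ℕ.+ u → correctionWeight R m j u ≡ 0ℚ
correctionWeight-vanish R m j u p = cases (R ℕ.≤? m ℕ.+ j)
  where
  cases : Dec (R ≤ m ℕ.+ j) → correctionWeight R m j u ≡ 0ℚ
  cases (yes q) = trans (cong (_* shiftedCoeff j u) (â-vanish R m j q)) (*-zeroˡ (shiftedCoeff j u))
  cases (no q) = trans (cong (â R m j *_) (shiftedCoeff-vanish j u (NP.+-cancelˡ-< m (suc j) u
      (NP.≤-<-trans (NP.≤-reflexive (NP.+-suc m j)) (NP.≤-<-trans (NP.≰⇒> q) p))))) (*-zeroʳ (â R m j))

â-suc-zero-top : ∀ r' → â (suc (suc r')) (suc r') 0 ≡ - sumFrom 0 (suc r') (λ m → sumFrom 0 (suc r') (λ j → shiftArg m (correctionWeight (suc r') m j) (suc r')))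
â-suc-zero-top r' = trans (if-true (≡ᵇ-true {suc r'} {suc r'} refl)) (cong -_ (sumFrom-cong 0 R _ _ (λ m _ m< → sym (perm m m<))))
  where
  R = suc r'
  perm : ∀ m → m < R → sumFrom 0 R (λ j → shiftArg m (correctionWeight R m j) R) ≡ â R m (R ∸ m ∸ 1) * inv1+ (R ∸ m ∸ 1)
  perm m m< = trans (sumFrom-cong 0 R (λ j → shiftArg m (correctionWeight R m j) R) (λ j → correctionWeight R m j (R ∸ m)) (λ j _ _ → shiftArg-val m (correctionWeight R m j) R (NP.<⇒≤ m<)))
    (trans (sumFrom-single 0 R (λ j → correctionWeight R m j (R ∸ m)) diag z≤n c0<
      (λ j _ _ j≢c0 → off-diagonal j j≢c0 (NP.<-cmp j diag)))
     (trans (cong (λ w → â R m diag * shiftedCoeff diag w) Rm) (cong (â R m diag *_) (trans (shiftedCoeff-top diag)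
       (trans (cong (λ w → inv1+ diag * ℕ→ℚ (suc diag C w) * B⁺ w) (NP.n∸n≡0 diag))
         (solve 1 (λ x → x :* con 1ℚ :* con 1ℚ := x) refl (inv1+ diag)))))))
    where
    diag = R ∸ m ∸ 1
    Rm : R ∸ m ≡ suc diag
    Rm = sym (NP.m+[n∸m]≡n (NP.m<n⇒0<n∸m m<))
    c0< : diag < R
    c0< = subst (_≤ R) Rm (NP.m∸n≤m R m)
    off-diagonal : ∀ j → j ≢ diag → Tri (j < diag) (j ≡ diag) (diag < j) → correctionWeight R m j (R ∸ m) ≡ 0ℚ
    off-diagonal j ne (tri< lt _ _) = trans (cong (â R m j *_) (shiftedCoeff-vanish j (R ∸ m) (subst (suc j <_) (sym Rm) (s≤s lt)))) (*-zeroʳ (â R m j))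
    off-diagonal j ne (tri≈ _ eq _) = ⊥-elim (ne eq)
    off-diagonal j ne (tri> _ _ gt) = trans (cong (_* shiftedCoeff j (R ∸ m)) (â-vanish′ R m j (subst (_≤ j) (sym Rm) gt))) (*-zeroˡ (shiftedCoeff j (R ∸ m)))

â-suc-zero : ∀ r' M → M ≤ suc r' → â (suc (suc r')) M 0 ≡ - sumFrom 0 (suc r') (λ m → sumFrom 0 (suc r') (λ j → shiftArg m (correctionWeight (suc r') m j) M))
â-suc-zero r' M M≤R = cases (M ℕ.≟ suc r')
  where
  R = suc r'
  cases : Dec (M ≡ suc r') → â (suc R) M 0 ≡ - sumFrom 0 R (λ m → sumFrom 0 R (λ j → shiftArg m (correctionWeight R m j) M))
  cases (yes eq) = subst (λ M' → â (suc R) M' 0 ≡ - sumFrom 0 R (λ m → sumFrom 0 R (λ j → shiftArg m (correctionWeight R m j) M'))) (sym eq) (â-suc-zero-top r')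
  cases (no M≢R) = trans (if-false (≡ᵇ-false M≢R)) (trans (if-true (≤ᵇ-true M<R)) (cong -_ levels))
    where
    M<R : suc M ≤ R
    M<R = NP.≤∧≢⇒< M≤R M≢R
    M≤r' : M ≤ r'
    M≤r' = NP.≤-pred M<R
    Y : ℕ → ℚ
    Y y = Σ[ max 0 (M ∸ y ∸ 1) to r' ∸ y ] (λ j → â R y j * D R M j y)
    levels : sumFrom 0 (suc M) Y ≡ sumFrom 0 R (λ m → sumFrom 0 R (λ j → shiftArg m (correctionWeight R m j) M))
    levels = sym (trans (sumFrom-extend 0 (suc M) R (λ m → sumFrom 0 R (λ j → shiftArg m (correctionWeight R m j) M)) M<R (λ m p _ → sumFrom-zero 0 R (λ j → shiftArg m (correctionWeight R m j) M) (λ j _ _ → shiftArg-vanish m (correctionWeight R m j) M p)))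
      (sumFrom-cong 0 (suc M) (λ m → sumFrom 0 R (λ j → shiftArg m (correctionWeight R m j) M)) Y (λ y _ y< → sym (level y (NP.≤-pred y<)))))
      where
      level : ∀ y → y ≤ M → Y y ≡ sumFrom 0 R (λ j → shiftArg y (correctionWeight R y j) M)
      level y y≤M = begin
          sumFrom (M ∸ y ∸ 1) (suc (r' ∸ y) ∸ (M ∸ y ∸ 1)) (λ j → â R y j * D R M j y)
        ≡⟨ sumFrom-cong (M ∸ y ∸ 1) (suc (r' ∸ y) ∸ (M ∸ y ∸ 1)) (λ j → â R y j * D R M j y) weight (λ j _ _ → cong (â R y j *_) (D≡shiftedCoeff R M j y y≤M)) ⟩
          sumFrom (M ∸ y ∸ 1) (suc (r' ∸ y) ∸ (M ∸ y ∸ 1)) weight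
        ≡⟨ sumFrom-dropZeros (M ∸ y ∸ 1) (suc (r' ∸ y)) weight
             (NP.≤-trans (NP.m∸n≤m (M ∸ y) 1) (NP.≤-trans (NP.∸-monoˡ-≤ y M≤r') (NP.n≤1+n (r' ∸ y))))
             (λ j j< → trans (cong (â R y j *_) (shiftedCoeff-vanish j (M ∸ y) (<∸1⇒suc< (M ∸ y) j j<))) (*-zeroʳ (â R y j))) ⟩
          sumFrom 0 (suc (r' ∸ y)) weight
        ≡⟨ sym (sumFrom-extend 0 (suc (r' ∸ y)) R weight (s≤s (NP.m∸n≤m r' y))
             (λ j p _ → trans (cong (_* shiftedCoeff j (M ∸ y)) (â-vanish′ R y j (subst (_≤ j) (sym (NP.+-∸-assoc 1 (NP.≤-trans y≤M M≤r'))) p))) (*-zeroˡ (shiftedCoeff j (M ∸ y))))) ⟩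
          sumFrom 0 R weight
        ≡⟨ sumFrom-cong 0 R weight (λ j → shiftArg y (correctionWeight R y j) M) (λ j _ _ → sym (shiftArg-val y (correctionWeight R y j) M y≤M)) ⟩
          sumFrom 0 R (λ j → shiftArg y (correctionWeight R y j) M) ∎
        where
        open ≡-Reasoning
        weight = λ j → correctionWeight R y j (M ∸ y)

hyperExpansion : ℕ → ℤ → ℕ → ℚ
hyperExpansion R z n = sumFrom 0 R (λ m → sumFrom 0 R (λ j → â R m j * pow n j * harm (z ℤ.- + m) n))

hyperExpansion-powerTerms : ∀ r' z n →
  sumFrom 0 (suc (suc r')) (λ m → sumFrom 0 (suc r') (λ ℓ → â (suc (suc r')) m (suc ℓ) * pow n (suc ℓ) * harm (z ℤ.- + m) n))
  ≡ sumFrom 0 (suc r') (λ m → sumFrom 0 (suc r') (λ j → â (suc r') m j * faulhaber j n * harm (z ℤ.- + m) n))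
hyperExpansion-powerTerms r' z n = trans (sumFrom-cong 0 (suc R) _ _ (λ m _ _ → level m))
  (sumFrom-extend 0 R (suc R) faulhaberLevel (NP.n≤1+n R) (λ m p q → sumFrom-zero 0 R _ (λ j _ _ →
     trans (cong (λ w → w * faulhaber j n * harm (z ℤ.- + m) n) (â-vanish R m j (NP.≤-trans p (NP.m≤m+n m j))))
       (trans (cong (_* harm (z ℤ.- + m) n) (*-zeroˡ (faulhaber j n))) (*-zeroˡ (harm (z ℤ.- + m) n))))))
  where
  open ≡-Reasoning
  R = suc r'
  X = λ ℓ → pow n (suc ℓ)
  faulhaberLevel = λ m → sumFrom 0 R (λ j → â R m j * faulhaber j n * harm (z ℤ.- + m) n)
  level : ∀ m → sumFrom 0 R (λ ℓ → â (suc R) m (suc ℓ) * X ℓ * harm (z ℤ.- + m) n) ≡ faulhaberLevel m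
  level m = begin
      sumFrom 0 R (λ ℓ → â (suc R) m (suc ℓ) * X ℓ * h)
    ≡⟨ sumFrom-cong 0 R _ _ (λ ℓ _ ℓ< → cong (λ w → w * X ℓ * h) (â-suc-suc r' m ℓ ℓ<)) ⟩
      sumFrom 0 R (λ ℓ → sumFrom ℓ (R ∸ ℓ) (λ j → â R m j * faulhaberCoeff j ℓ) * X ℓ * h)
    ≡⟨ sumFrom-cong 0 R _ _ (λ ℓ _ _ → trans (cong (_* h) (*-distribʳ-sumFrom ℓ (R ∸ ℓ) (X ℓ) (λ j → â R m j * faulhaberCoeff j ℓ)))
          (*-distribʳ-sumFrom ℓ (R ∸ ℓ) h (λ j → â R m j * faulhaberCoeff j ℓ * X ℓ))) ⟩
      sumFrom 0 R (λ ℓ → sumFrom ℓ (R ∸ ℓ) (λ j → f j ℓ))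
    ≡⟨ sym (sumFrom-triangle R f) ⟩
      sumFrom 0 R (λ j → sumFrom 0 (suc j) (f j))
    ≡⟨ sumFrom-cong 0 R _ _ (λ j _ _ → collect-j j) ⟩
      faulhaberLevel m ∎
    where
    h = harm (z ℤ.- + m) n
    f = λ j ℓ → â R m j * faulhaberCoeff j ℓ * X ℓ * h
    collect-j : ∀ j → sumFrom 0 (suc j) (f j) ≡ â R m j * faulhaber j n * h
    collect-j j = sym (trans (cong (_* h) (*-distribˡ-sumFrom 0 (suc j) (â R m j) (λ ℓ → faulhaberCoeff j ℓ * X ℓ)))
      (trans (*-distribʳ-sumFrom 0 (suc j) h (λ ℓ → â R m j * (faulhaberCoeff j ℓ * X ℓ)))
        (sumFrom-cong 0 (suc j) _ _ (λ ℓ _ _ → solve 4 (λ a b x y → a :* (b :* x) :* y := a :* b :* x :* y) refl (â R m j) (faulhaberCoeff j ℓ) (X ℓ) h))))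

hyperExpansion-constantTerms : ∀ r' z n →
  sumFrom 0 (suc (suc r')) (λ M → â (suc (suc r')) M 0 * pow n 0 * harm (z ℤ.- + M) n)
  ≡ - sumFrom 0 (suc r') (λ m → sumFrom 0 (suc r') (λ j → â (suc r') m j * sumFrom 0 (suc (suc j)) (λ u → shiftedCoeff j u * harm (z ℤ.- + (m ℕ.+ u)) n)))
hyperExpansion-constantTerms r' z n = begin
    sumFrom 0 (suc R) (λ M → â (suc R) M 0 * pow n 0 * hh M)
  ≡⟨ sumFrom-cong 0 (suc R) _ _ (λ M _ M< → trans (cong (λ w → w * pow n 0 * hh M) (â-suc-zero r' M (NP.≤-pred M<))) (factor-out M)) ⟩
    sumFrom 0 (suc R) (λ M → - sumFrom 0 R (λ m → sumFrom 0 R (λ j → shiftArg m (correctionWeight R m j) M * hh M)))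
  ≡⟨ sym (neg-distrib-sumFrom 0 (suc R) (λ M → sumFrom 0 R (λ m → sumFrom 0 R (λ j → shiftArg m (correctionWeight R m j) M * hh M)))) ⟩
    - sumFrom 0 (suc R) (λ M → sumFrom 0 R (λ m → sumFrom 0 R (λ j → shiftArg m (correctionWeight R m j) M * hh M)))
  ≡⟨ cong -_ (trans (sumFrom-swap 0 (suc R) 0 R (λ M m → sumFrom 0 R (λ j → shiftArg m (correctionWeight R m j) M * hh M)))
       (sumFrom-cong 0 R _ _ (λ m _ _ → trans (sumFrom-swap 0 (suc R) 0 R (λ M j → shiftArg m (correctionWeight R m j) M * hh M))
          (sumFrom-cong 0 R _ _ (λ j _ j< → unshift m j))))) ⟩
    - sumFrom 0 R (λ m → sumFrom 0 R (λ j → sumFrom 0 (suc R) (λ u → correctionWeight R m j u * hh (m ℕ.+ u))))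
  ≡⟨ cong -_ (sumFrom-cong 0 R _ _ (λ m _ _ → sumFrom-cong 0 R _ _ (λ j _ j< → sym (pad m j j<)))) ⟩
    - sumFrom 0 R (λ m → sumFrom 0 R (λ j → â R m j * sumFrom 0 (suc (suc j)) (λ u → shiftedCoeff j u * hh (m ℕ.+ u)))) ∎
  where
  open ≡-Reasoning
  R = suc r'
  hh = λ M → harm (z ℤ.- + M) n
  factor-out : ∀ M → - sumFrom 0 R (λ m → sumFrom 0 R (λ j → shiftArg m (correctionWeight R m j) M)) * pow n 0 * hh M
             ≡ - sumFrom 0 R (λ m → sumFrom 0 R (λ j → shiftArg m (correctionWeight R m j) M * hh M))
  factor-out M = trans (solve 2 (λ S h → :- S :* con 1ℚ :* h := :- (S :* h)) refl (sumFrom 0 R (λ m → sumFrom 0 R (λ j → shiftArg m (correctionWeight R m j) M))) (hh M))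
    (cong -_ (trans (*-distribʳ-sumFrom 0 R (hh M) (λ m → sumFrom 0 R (λ j → shiftArg m (correctionWeight R m j) M))) (sumFrom-cong 0 R (λ m → sumFrom 0 R (λ j → shiftArg m (correctionWeight R m j) M) * hh M) (λ m → sumFrom 0 R (λ j → shiftArg m (correctionWeight R m j) M * hh M)) (λ m _ _ → *-distribʳ-sumFrom 0 R (hh M) (λ j → shiftArg m (correctionWeight R m j) M)))))
  unshift : ∀ m j → sumFrom 0 (suc R) (λ M → shiftArg m (correctionWeight R m j) M * hh M) ≡ sumFrom 0 (suc R) (λ u → correctionWeight R m j u * hh (m ℕ.+ u))
  unshift m j = trans (shiftArg-sum m (correctionWeight R m j) hh (suc R))
    (sym (sumFrom-extend 0 (suc R ∸ m) (suc R) _ (NP.m∸n≤m (suc R) m)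
      (λ u p _ → trans (cong (_* hh (m ℕ.+ u)) (correctionWeight-vanish R m j u (NP.<-≤-trans (NP.m≤n+m∸n (suc R) m) (NP.+-monoʳ-≤ m p)))) (*-zeroˡ (hh (m ℕ.+ u))))))
  pad : ∀ m j → j < R → â R m j * sumFrom 0 (suc (suc j)) (λ u → shiftedCoeff j u * hh (m ℕ.+ u)) ≡ sumFrom 0 (suc R) (λ u → correctionWeight R m j u * hh (m ℕ.+ u))
  pad m j j< = trans (*-distribˡ-sumFrom 0 (suc (suc j)) (â R m j) _)
    (trans (sumFrom-cong 0 (suc (suc j)) _ _ (λ u _ _ → sym (*-assoc (â R m j) (shiftedCoeff j u) (hh (m ℕ.+ u)))))
     (sym (sumFrom-extend 0 (suc (suc j)) (suc R) _ (s≤s j<)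
       (λ u p _ → trans (cong (λ w → â R m j * w * hh (m ℕ.+ u)) (shiftedCoeff-vanish j u p))
          (trans (cong (_* hh (m ℕ.+ u)) (*-zeroʳ (â R m j))) (*-zeroˡ (hh (m ℕ.+ u))))))))

hyper≡hyperExpansion : ∀ r z n → hyper z (suc r) n ≡ hyperExpansion (suc r) z n
hyper≡hyperExpansion zero z n = sym (trans (cong (λ w → 1ℚ * 1ℚ * harm w n + 0ℚ + 0ℚ) (ZP.+-identityʳ z))
  (solve 1 (λ h → con 1ℚ :* con 1ℚ :* h :+ con 0ℚ :+ con 0ℚ := h) refl (harm z n)))
hyper≡hyperExpansion (suc r') z n = begin
    sumFrom 1 n (λ ℓ → hyper z R ℓ)
  ≡⟨ sumFrom-cong 1 n _ _ (λ ℓ _ _ → hyper≡hyperExpansion r' z ℓ) ⟩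
    sumFrom 1 n (hyperExpansion R z)
  ≡⟨ sym (trans (cong (_+ sumFrom 1 n (hyperExpansion R z)) expansion-at-0) (+-identityˡ _)) ⟩
    sumFrom 0 (suc n) (hyperExpansion R z)
  ≡⟨ trans (sumFrom-swap₃ 0 (suc n) 0 R 0 R (λ ℓ m j → â R m j * pow ℓ j * harm (z ℤ.- + m) ℓ))
       (sumFrom-cong 0 R _ _ (λ m _ _ → sumFrom-cong 0 R _ _ (λ j _ _ → sumOver-ℓ m j))) ⟩
    sumFrom 0 R (λ m → sumFrom 0 R (λ j → faulhaberPart m j + - shiftedPart m j))
  ≡⟨ sumFrom²-minus 0 R 0 R faulhaberPart shiftedPart ⟩
    sumFrom 0 R (λ m → sumFrom 0 R (faulhaberPart m)) + - sumFrom 0 R (λ m → sumFrom 0 R (shiftedPart m))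
  ≡⟨ cong₂ _+_ (sym (hyperExpansion-powerTerms r' z n)) (sym (hyperExpansion-constantTerms r' z n)) ⟩
    sumFrom 0 (suc R) (λ m → sumFrom 0 R (λ ℓ → F m (suc ℓ))) + sumFrom 0 (suc R) (λ M → F M 0)
  ≡⟨ trans (+-comm (sumFrom 0 (suc R) (λ m → sumFrom 0 R (λ ℓ → F m (suc ℓ)))) (sumFrom 0 (suc R) (λ M → F M 0))) (sym (sumFrom-+ 0 (suc R) (λ M → F M 0) (λ m → sumFrom 0 R (λ ℓ → F m (suc ℓ))))) ⟩
    sumFrom 0 (suc R) (λ m → F m 0 + sumFrom 0 R (λ ℓ → F m (suc ℓ)))
  ≡⟨ sumFrom-cong 0 (suc R) _ _ (λ m _ _ → sym (sumFrom-head R (F m))) ⟩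
    hyperExpansion (suc R) z n ∎
  where
  open ≡-Reasoning
  R = suc r'
  F = λ m e → â (suc R) m e * pow n e * harm (z ℤ.- + m) n
  faulhaberPart = λ m j → â R m j * faulhaber j n * harm (z ℤ.- + m) n
  shiftedPart = λ m j → â R m j * sumFrom 0 (suc (suc j)) (λ u → shiftedCoeff j u * harm (z ℤ.- + (m ℕ.+ u)) n)
  expansion-at-0 : hyperExpansion R z 0 ≡ 0ℚ
  expansion-at-0 = sumFrom-zero 0 R _ (λ m _ _ → sumFrom-zero 0 R _ (λ j _ _ → *-zeroʳ (â R m j * pow 0 j)))
  sumOver-ℓ : ∀ m j → sumFrom 0 (suc n) (λ ℓ → â R m j * pow ℓ j * harm (z ℤ.- + m) ℓ) ≡ faulhaberPart m j + - shiftedPart m j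
  sumOver-ℓ m j = begin
      sumFrom 0 (suc n) (λ ℓ → â R m j * pow ℓ j * harm (z ℤ.- + m) ℓ)
    ≡⟨ trans (sumFrom-cong 0 (suc n) _ _ (λ ℓ _ _ → *-assoc (â R m j) (pow ℓ j) (harm (z ℤ.- + m) ℓ))) (sym (*-distribˡ-sumFrom 0 (suc n) (â R m j) _)) ⟩
      â R m j * sumFrom 0 (suc n) (λ ℓ → pow ℓ j * harm (z ℤ.- + m) ℓ)
    ≡⟨ cong (â R m j *_) (sumPow*harm-faulhaber j (z ℤ.- + m) n) ⟩
      â R m j * (faulhaber j n * harm (z ℤ.- + m) n - sumFrom 0 (suc (suc j)) (λ u → shiftedCoeff j u * harm ((z ℤ.- + m) ℤ.- + u) n))
    ≡⟨ cong (λ w → â R m j * (faulhaber j n * harm (z ℤ.- + m) n - w)) (sumFrom-cong 0 (suc (suc j)) _ _ (λ u _ _ → cong (λ w → shiftedCoeff j u * harm w n) (z-m-u≡z-[m+u] z m u))) ⟩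
      â R m j * (faulhaber j n * harm (z ℤ.- + m) n - sumFrom 0 (suc (suc j)) (λ u → shiftedCoeff j u * harm (z ℤ.- + (m ℕ.+ u)) n))
    ≡⟨ solve 4 (λ a p h s → a :* (p :* h :- s) := a :* p :* h :+ :- (a :* s)) refl (â R m j) (faulhaber j n) (harm (z ℤ.- + m) n) (sumFrom 0 (suc (suc j)) (λ u → shiftedCoeff j u * harm (z ℤ.- + (m ℕ.+ u)) n)) ⟩
      faulhaberPart m j + - shiftedPart m j ∎

-- Both sides of the identity

module Sides (p r' n : ℕ) (z : ℤ) where
  R : ℕ
  R = suc r'

  harmShift : ℕ → ℚ
  harmShift M = harm (z ℤ.- + M) n
  corrCoeff : ℕ → ℕ → ℚ
  corrCoeff m t = sumFrom 0 R (λ j → â R m j * Hs (p ℕ.+ j) t)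
  mainPart correctionPart : ℚ
  mainPart = sumFrom 0 R (λ m → sumFrom 0 R (λ j → â R m j * A (p ℕ.+ j) n * harmShift m))
  correctionPart = sumFrom 0 R (λ m → sumFrom 1 (p ℕ.+ R ∸ m) (λ t → corrCoeff m t * harmShift (m ℕ.+ t)))

  correctionTerm : ℕ → ℕ → ℚ
  correctionTerm m j = â R m j * sumFrom 0 (suc (suc (p ℕ.+ j))) (λ u → Hs (p ℕ.+ j) u * harmShift (m ℕ.+ u))

  correctionTerm-window : ∀ m j → m < R → correctionTerm m j ≡ sumFrom 1 (p ℕ.+ R ∸ m) (λ t → â R m j * Hs (p ℕ.+ j) t * harmShift (m ℕ.+ t))
  correctionTerm-window m j m< = byCases (R ℕ.≤? m ℕ.+ j)
    where
    f : ℕ → ℚ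
    f t = â R m j * Hs (p ℕ.+ j) t * harmShift (m ℕ.+ t)
    byCases : Dec (R ≤ m ℕ.+ j) → correctionTerm m j ≡ sumFrom 1 (p ℕ.+ R ∸ m) f
    byCases (yes q) = trans (trans (cong (_* sumFrom 0 (suc (suc (p ℕ.+ j))) (λ u → Hs (p ℕ.+ j) u * harmShift (m ℕ.+ u))) (â-vanish R m j q)) (*-zeroˡ (sumFrom 0 (suc (suc (p ℕ.+ j))) (λ u → Hs (p ℕ.+ j) u * harmShift (m ℕ.+ u)))))
      (sym (sumFrom-zero 1 (p ℕ.+ R ∸ m) f (λ t _ _ → trans (cong (λ w → w * Hs (p ℕ.+ j) t * harmShift (m ℕ.+ t)) (â-vanish R m j q))
          (trans (cong (_* harmShift (m ℕ.+ t)) (*-zeroˡ (Hs (p ℕ.+ j) t))) (*-zeroˡ (harmShift (m ℕ.+ t)))))))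
    byCases (no q) = begin
        correctionTerm m j
      ≡⟨ trans (*-distribˡ-sumFrom 0 (suc (suc (p ℕ.+ j))) (â R m j) (λ u → Hs (p ℕ.+ j) u * harmShift (m ℕ.+ u)))
           (sumFrom-cong 0 (suc (suc (p ℕ.+ j))) _ f (λ u _ _ → sym (*-assoc (â R m j) (Hs (p ℕ.+ j) u) (harmShift (m ℕ.+ u))))) ⟩
        sumFrom 0 (suc (suc (p ℕ.+ j))) f
      ≡⟨ sumFrom-head (suc (p ℕ.+ j)) f ⟩
        f 0 + sumFrom 0 (suc (p ℕ.+ j)) (λ t → f (suc t))
      ≡⟨ cong₂ _+_ (trans (cong (λ w → â R m j * w * harmShift (m ℕ.+ 0)) (Hs-0 (p ℕ.+ j))) (trans (cong (_* harmShift (m ℕ.+ 0)) (*-zeroʳ (â R m j))) (*-zeroˡ (harmShift (m ℕ.+ 0)))))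
           (sym (sumFrom-suc 0 (suc (p ℕ.+ j)) f)) ⟩
        0ℚ + sumFrom 1 (suc (p ℕ.+ j)) f
      ≡⟨ +-identityˡ (sumFrom 1 (suc (p ℕ.+ j)) f) ⟩
        sumFrom 1 (suc (p ℕ.+ j)) f
      ≡⟨ sym (sumFrom-extend 1 (suc (p ℕ.+ j)) (p ℕ.+ R ∸ m) f top≤window
           (λ t lo _ → trans (cong (λ w → â R m j * w * harmShift (m ℕ.+ t)) (Hs-vanish (p ℕ.+ j) t lo))
              (trans (cong (_* harmShift (m ℕ.+ t)) (*-zeroʳ (â R m j))) (*-zeroˡ (harmShift (m ℕ.+ t)))))) ⟩
        sumFrom 1 (p ℕ.+ R ∸ m) f ∎
      where
      open ≡-Reasoning
      top≤window : suc (p ℕ.+ j) ≤ p ℕ.+ R ∸ m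
      top≤window = subst (suc (p ℕ.+ j) ≤_) (sym (NP.+-∸-assoc p (NP.<⇒≤ m<)))
        (subst (_≤ p ℕ.+ (R ∸ m)) (NP.+-suc p j)
          (NP.+-monoʳ-≤ p (subst (_≤ R ∸ m) (NP.m+n∸m≡n m (suc j)) (NP.∸-monoˡ-≤ m (subst (_≤ R) (sym (NP.+-suc m j)) (NP.≰⇒> q))))))

  lhs≡main-correction : sumFrom 0 (suc n) (λ ℓ → pow ℓ p * hyper z R ℓ) ≡ mainPart + - correctionPart
  lhs≡main-correction = begin
      sumFrom 0 (suc n) (λ ℓ → pow ℓ p * hyper z R ℓ)
    ≡⟨ sumFrom-cong 0 (suc n) _ _ (λ ℓ _ _ → trans (cong (pow ℓ p *_) (hyper≡hyperExpansion r' z ℓ)) (pow*expansion ℓ)) ⟩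
      sumFrom 0 (suc n) (λ ℓ → sumFrom 0 R (λ m → sumFrom 0 R (λ j → term ℓ m j)))
    ≡⟨ sumFrom-swap₃ 0 (suc n) 0 R 0 R term ⟩
      sumFrom 0 R (λ m → sumFrom 0 R (λ j → sumFrom 0 (suc n) (λ ℓ → term ℓ m j)))
    ≡⟨ sumFrom-cong 0 R _ _ (λ m _ _ → sumFrom-cong 0 R _ _ (λ j _ _ → sumOver-ℓ m j)) ⟩
      sumFrom 0 R (λ m → sumFrom 0 R (λ j → mainTerm m j + - correctionTerm m j))
    ≡⟨ sumFrom²-minus 0 R 0 R mainTerm correctionTerm ⟩
      mainPart + - sumFrom 0 R (λ m → sumFrom 0 R (correctionTerm m))
    ≡⟨ cong (λ w → mainPart + - w) (sumFrom-cong 0 R _ _ (λ m _ m< → correction-byLevel m m<)) ⟩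
      mainPart + - correctionPart ∎
    where
    open ≡-Reasoning
    term : ℕ → ℕ → ℕ → ℚ
    term ℓ m j = â R m j * (pow ℓ (p ℕ.+ j) * harm (z ℤ.- + m) ℓ)
    mainTerm : ℕ → ℕ → ℚ
    mainTerm m j = â R m j * A (p ℕ.+ j) n * harmShift m
    pow*expansion : ∀ ℓ → pow ℓ p * hyperExpansion R z ℓ ≡ sumFrom 0 R (λ m → sumFrom 0 R (λ j → term ℓ m j))
    pow*expansion ℓ = trans (*-distribˡ-sumFrom 0 R (pow ℓ p) _) (sumFrom-cong 0 R _ _ (λ m _ _ → trans (*-distribˡ-sumFrom 0 R (pow ℓ p) _)
      (sumFrom-cong 0 R _ _ (λ j _ _ → trans (solve 4 (λ x a y h → x :* (a :* y :* h) := a :* (x :* y :* h)) refl (pow ℓ p) (â R m j) (pow ℓ j) (harm (z ℤ.- + m) ℓ))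
        (cong (λ w → â R m j * (w * harm (z ℤ.- + m) ℓ)) (sym (qpow-+ (ℕ→ℚ ℓ) p j)))))))
    sumOver-ℓ : ∀ m j → sumFrom 0 (suc n) (λ ℓ → term ℓ m j) ≡ mainTerm m j + - correctionTerm m j
    sumOver-ℓ m j = begin
        sumFrom 0 (suc n) (λ ℓ → term ℓ m j)
      ≡⟨ sym (*-distribˡ-sumFrom 0 (suc n) (â R m j) (λ ℓ → pow ℓ (p ℕ.+ j) * harm (z ℤ.- + m) ℓ)) ⟩
        â R m j * sumFrom 0 (suc n) (λ ℓ → pow ℓ (p ℕ.+ j) * harm (z ℤ.- + m) ℓ)
      ≡⟨ cong (â R m j *_) (sumPow*harm-A (p ℕ.+ j) (z ℤ.- + m) n) ⟩
        â R m j * (A (p ℕ.+ j) n * harmShift m - sumFrom 0 (suc (suc (p ℕ.+ j))) (λ u → Hs (p ℕ.+ j) u * harm ((z ℤ.- + m) ℤ.- + u) n))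
      ≡⟨ cong (λ w → â R m j * (A (p ℕ.+ j) n * harmShift m - w)) (sumFrom-cong 0 (suc (suc (p ℕ.+ j))) _ _ (λ u _ _ → cong (λ w → Hs (p ℕ.+ j) u * harm w n) (z-m-u≡z-[m+u] z m u))) ⟩
        â R m j * (A (p ℕ.+ j) n * harmShift m - sumFrom 0 (suc (suc (p ℕ.+ j))) (λ u → Hs (p ℕ.+ j) u * harmShift (m ℕ.+ u)))
      ≡⟨ solve 4 (λ a x h s → a :* (x :* h :- s) := a :* x :* h :+ :- (a :* s)) refl (â R m j) (A (p ℕ.+ j) n) (harmShift m) (sumFrom 0 (suc (suc (p ℕ.+ j))) (λ u → Hs (p ℕ.+ j) u * harmShift (m ℕ.+ u))) ⟩
        mainTerm m j + - correctionTerm m j ∎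
    correction-byLevel : ∀ m → m < R → sumFrom 0 R (correctionTerm m) ≡ sumFrom 1 (p ℕ.+ R ∸ m) (λ t → corrCoeff m t * harmShift (m ℕ.+ t))
    correction-byLevel m m< = trans (sumFrom-cong 0 R _ _ (λ j _ _ → correctionTerm-window m j m<))
      (trans (sumFrom-swap 0 R 1 (p ℕ.+ R ∸ m) (λ j t → â R m j * Hs (p ℕ.+ j) t * harmShift (m ℕ.+ t)))
        (sumFrom-cong 1 (p ℕ.+ R ∸ m) _ _ (λ t _ _ → sym (*-distribʳ-sumFrom 0 R (harmShift (m ℕ.+ t)) (λ j → â R m j * Hs (p ℕ.+ j) t)))))

  bMain : ℕ → ℚ
  bMain y = sumFrom 0 R (λ j → â R y j * A (p ℕ.+ j) n)

  corrWindow : ℕ → ℕ → ℚ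
  corrWindow m t = Σ[ max 0 (t ∸ p ∸ 1) to R ∸ 1 ∸ m ] (λ j → â R m j * Hs (p ℕ.+ j) t)

  corrSelect : ℕ → ℕ → ℕ → ℚ
  corrSelect m t y = if (m ℕ.+ t) ≡ᵇ y then corrWindow m t else 0ℚ

  corr-0 : corr p R 0 ≡ 0ℚ
  corr-0 = sumFrom-zero 0 R _ (λ m _ _ → sumFrom-zero 1 (p ℕ.+ R ∸ m) (λ t → corrSelect m t 0)
    (λ t 1≤t _ → if-false (≡ᵇ-false {m ℕ.+ t} {0} (λ e → NP.<-irrefl (sym e) (NP.<-≤-trans 1≤t (NP.m≤n+m t m))))))

  b≡bMain-corr : ∀ y → b p R n y ≡ bMain y - corr p R y
  b≡bMain-corr zero = sym (trans (cong (λ w → bMain 0 - w) corr-0) (solve 1 (λ x → x :- con 0ℚ := x) refl (bMain 0)))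
  b≡bMain-corr (suc y') = byCases (suc y' ℕ.≤? r')
    where
    byCases : Dec (suc y' ≤ r') → b p R n (suc y') ≡ bMain (suc y') - corr p R (suc y')
    byCases (yes q) = trans (if-true (≤ᵇ-true q)) (cong (_- corr p R (suc y'))
      (sym (sumFrom-extend 0 (suc (r' ∸ suc y')) R (λ j → â R (suc y') j * A (p ℕ.+ j) n) (s≤s (NP.m∸n≤m r' (suc y')))
        (λ j lo _ → trans (cong (_* A (p ℕ.+ j) n) (â-vanish′ R (suc y') j (subst (_≤ j) (sym (NP.+-∸-assoc 1 q)) lo))) (*-zeroˡ (A (p ℕ.+ j) n))))))
    byCases (no q) = trans (if-false (≤ᵇ-false q)) (sym (trans (cong (_- corr p R (suc y'))
       (sumFrom-zero 0 R (λ j → â R (suc y') j * A (p ℕ.+ j) n) (λ j _ _ → trans (cong (_* A (p ℕ.+ j) n)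
          (â-vanish R (suc y') j (NP.≤-trans (NP.≰⇒> q) (NP.m≤m+n (suc y') j)))) (*-zeroˡ (A (p ℕ.+ j) n)))))
       (+-identityˡ _)))

  below-window : ∀ t p j → j < t ∸ p ∸ 1 → suc (p ℕ.+ j) < t
  below-window (suc t) zero j q = s≤s q
  below-window (suc t) (suc p) j q = s≤s (below-window t p j q)
  below-window zero p j q = ⊥-elim (NP.n≮0 (subst (j <_) (trans (cong (_∸ 1) (NP.0∸n≡0 p)) refl) q))

  corrWindow≡corrCoeff : ∀ m t → m < R → corrWindow m t ≡ corrCoeff m t
  corrWindow≡corrCoeff m t m< = sumFrom-window (t ∸ p ∸ 1) (r' ∸ m) R (λ j → â R m j * Hs (p ℕ.+ j) t) (s≤s (NP.m∸n≤m r' m))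
    (λ j j< → trans (cong (â R m j *_) (Hs-vanish (p ℕ.+ j) t (below-window t p j j<))) (*-zeroʳ (â R m j)))
    (λ j hi _ → trans (cong (_* Hs (p ℕ.+ j) t) (â-vanish′ R m j (subst (_≤ j) (sym (NP.+-∸-assoc 1 (NP.≤-pred m<))) hi))) (*-zeroˡ (Hs (p ℕ.+ j) t)))

  corrSelect-sum : ∀ m t → m < R → t < 1 ℕ.+ (p ℕ.+ R ∸ m) → sumFrom 0 (suc (p ℕ.+ R)) (λ y → corrSelect m t y * harmShift y) ≡ corrCoeff m t * harmShift (m ℕ.+ t)
  corrSelect-sum m t m< t< = trans (sumFrom-single 0 (suc (p ℕ.+ R)) (λ y → corrSelect m t y * harmShift y) (m ℕ.+ t) z≤n m+t<
      (λ y _ _ y≢ → trans (cong (_* harmShift y) (if-false (≡ᵇ-false (λ e → y≢ (sym e))))) (*-zeroˡ (harmShift y))))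
    (trans (cong (_* harmShift (m ℕ.+ t)) (if-true (≡ᵇ-true {m ℕ.+ t} {m ℕ.+ t} refl))) (cong (_* harmShift (m ℕ.+ t)) (corrWindow≡corrCoeff m t m<)))
    where
    m+t< : m ℕ.+ t < suc (p ℕ.+ R)
    m+t< = s≤s (NP.≤-trans (NP.+-monoʳ-≤ m (NP.≤-pred t<)) (NP.≤-reflexive (NP.m+[n∸m]≡n (NP.≤-trans (NP.<⇒≤ m<) (NP.m≤n+m R p)))))

  rhs≡main-correction : sumFrom 0 (suc (p ℕ.+ R)) (λ y → b p R n y * harmShift y) ≡ mainPart + - correctionPart
  rhs≡main-correction = begin
      sumFrom 0 (suc (p ℕ.+ R)) (λ y → b p R n y * harmShift y)
    ≡⟨ sumFrom-cong 0 (suc (p ℕ.+ R)) _ _ (λ y _ _ → trans (cong (_* harmShift y) (b≡bMain-corr y))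
         (solve 3 (λ a c h → (a :- c) :* h := a :* h :+ :- (c :* h)) refl (bMain y) (corr p R y) (harmShift y))) ⟩
      sumFrom 0 (suc (p ℕ.+ R)) (λ y → bMain y * harmShift y + - (corr p R y * harmShift y))
    ≡⟨ trans (sumFrom-+ 0 (suc (p ℕ.+ R)) (λ y → bMain y * harmShift y) (λ y → - (corr p R y * harmShift y)))
         (cong (λ w → sumFrom 0 (suc (p ℕ.+ R)) (λ y → bMain y * harmShift y) + w) (sym (neg-distrib-sumFrom 0 (suc (p ℕ.+ R)) (λ y → corr p R y * harmShift y)))) ⟩
      sumFrom 0 (suc (p ℕ.+ R)) (λ y → bMain y * harmShift y) + - sumFrom 0 (suc (p ℕ.+ R)) (λ y → corr p R y * harmShift y)
    ≡⟨ cong₂ (λ a b → a + - b) regroup-main regroup-correction ⟩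
      mainPart + - correctionPart ∎
    where
    open ≡-Reasoning
    regroup-main : sumFrom 0 (suc (p ℕ.+ R)) (λ y → bMain y * harmShift y) ≡ mainPart
    regroup-main = trans (sumFrom-extend 0 R (suc (p ℕ.+ R)) (λ y → bMain y * harmShift y) (NP.≤-trans (NP.m≤n+m R p) (NP.n≤1+n _))
           (λ y lo _ → trans (cong (_* harmShift y) (sumFrom-zero 0 R (λ j → â R y j * A (p ℕ.+ j) n)
              (λ j _ _ → trans (cong (_* A (p ℕ.+ j) n) (â-vanish R y j (NP.≤-trans lo (NP.m≤m+n y j)))) (*-zeroˡ (A (p ℕ.+ j) n))))) (*-zeroˡ (harmShift y))))
         (sumFrom-cong 0 R _ _ (λ m _ _ → *-distribʳ-sumFrom 0 R (harmShift m) (λ j → â R m j * A (p ℕ.+ j) n)))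
    regroup-correction : sumFrom 0 (suc (p ℕ.+ R)) (λ y → corr p R y * harmShift y) ≡ correctionPart
    regroup-correction = trans (sumFrom-cong 0 (suc (p ℕ.+ R)) _ _ (λ y _ _ → trans (*-distribʳ-sumFrom 0 R (harmShift y) (λ m → sumFrom 1 (p ℕ.+ R ∸ m) (λ t → corrSelect m t y)))
              (sumFrom-cong 0 R _ _ (λ m _ _ → *-distribʳ-sumFrom 1 (p ℕ.+ R ∸ m) (harmShift y) (λ t → corrSelect m t y)))))
      (trans (sumFrom-swap 0 (suc (p ℕ.+ R)) 0 R (λ y m → sumFrom 1 (p ℕ.+ R ∸ m) (λ t → corrSelect m t y * harmShift y)))
        (sumFrom-cong 0 R _ _ (λ m _ m< → trans (sumFrom-swap 0 (suc (p ℕ.+ R)) 1 (p ℕ.+ R ∸ m) (λ y t → corrSelect m t y * harmShift y))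
          (sumFrom-cong 1 (p ℕ.+ R ∸ m) _ _ (λ t _ t< → corrSelect-sum m t m< t<)))))

sumPow*hyper : ∀ p r' n (z : ℤ) →
  sumFrom 0 (suc n) (λ ℓ → pow ℓ p * hyper z (suc r') ℓ)
    ≡ sumFrom 0 (suc (p ℕ.+ suc r')) (λ y → b p (suc r') n y * harm (z ℤ.- + y) n)
sumPow*hyper p r' n z = trans lhs≡main-correction (sym rhs≡main-correction)
  where open Sides p r' n z

theorem5 : (n p q r : ℕ) → 1 ≤ n → 1 ≤ p → 1 ≤ q → 1 ≤ r → r ≤ q →
    Σ[ 0 to n ] (λ ℓ → qpow (ℕ→ℚ ℓ) p * hyper (+ q) r ℓ)
    ≡ Σ[ 0 to p ℕ.+ r ] (λ y → b p r n y * harm (+ q ℤ.- + y) n)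
theorem5 n p q (suc r') _ _ _ _ _ = sumPow*hyper p r' n (+ q)
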